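{- Let $C$ be a conjunction of inequalities of the form $x_a\le x_b$ or $x_a<x_b$ ($a,b\in[n]$) which is almost open of dimension $d$. Then $C$ (i.e., the collection of faces $\sigma_\Phi$ of the braid triangulation of $(0,1)^n$ contained in the solution set of $C$) is partitionable.
   Context: An ordered set partition $\Phi=(\Phi_1|\cdots|\Phi_\ell)$ of $[n]$ is a sequence of nonempty pairwise disjoint blocks with union $[n]$, of length $\ell(\Phi)=\ell$; for $x\in\mathbb{R}^n$, $\Delta(x)$ is the ordered set partition with $x$ constant on blocks and strictly increasing from block to block. The sets $\sigma_\Phi=\{x\in(0,1)^n:\Delta(x)=\Phi\}$ are relatively open unimodular simplices of dimension $\ell(\Phi)$ forming a triangulation of the open cube $(0,1)^n$; $\sigma_\Phi$ lies in the closure of $\sigma_\Psi$ iff $\Psi$ refines $\Phi$ (each block of $\Phi$ is a union of consecutive blocks of $\Psi$). A conjunction $C$ of such inequalities is identified with the polytope $\{x\in\mathbb{R}^n:C(x)\text{ and }0<x_i<1\ \forall i\}$, which is a union of simplices $\sigma_\Phi$; its dimension is that of this set. $C$ is almost open if (together with $0<x_i<1$) it is equivalent to a conjunction of linear inequalities, all facet-defining for the polytope, of which at most one is weak. A collection $K$ of faces $\sigma_\Phi$ whose maximal faces all have dimension $d$ is partitionable if it is a disjoint union of half-open $d$-dimensional simplices; equivalently, $\{\Phi:\sigma_\Phi\in K\}$ can be partitioned into intervals $[\Phi_c,\Phi_f]=\{\Phi:\Phi_f\text{ refines }\Phi\text{ refines }\Phi_c\}$ with $\ell(\Phi_f)=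d$.
   Formalization: The polytope, dimensions, closures and simplices $\sigma_\Phi$ are taken over points with rational coordinates, and the facet-defining inequalities witnessing that C is almost open have rational coefficients. -}

module Defs where

open import Data.Nat as ℕ using (ℕ; zero; suc)
open import Data.Fin as Fin using (Fin)
open import Data.Rational using (ℚ; 0ℚ; 1ℚ; _<_; _≤_; _+_; _*_; _-_; ∣_∣)
open import Data.List using (List; []; _∷_)
open import Data.List.Relation.Unary.All using (All)
open import Data.Product using (Σ; ∃; _×_; proj₁; proj₂)
open import Relation.Binary.PropositionalEquality using (_≡_)
open import Relation.Nullary using (¬_)
open import Function.Bundles using (_⇔_)

Point : ℕ → Set
Point n = Fin n → ℚ

PSet : ℕ → Set₁
PSet n = Point n → Set

InOpenCube : ∀ {n} → Point n → Set
InOpenCube x = ∀ i → (0ℚ < x i) × (x i < 1ℚ)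

data Strictness : Set where
  weak strict : Strictness

record BasicIneq (n : ℕ) : Set where
  constructor bineq
  field
    lhs : Fin n
    rhs : Fin n
    kind : Strictness

holdsBasic : ∀ {n} → BasicIneq n → Point n → Set
holdsBasic (bineq a b weak) x = x a ≤ x b
holdsBasic (bineq a b strict) x = x a < x b

Conj : ℕ → Set
Conj n = List (BasicIneq n)

SatC : ∀ {n} → Conj n → Point n → Set
SatC C x = All (λ ι → holdsBasic ι x) C

Sol : ∀ {n} → Conj n → PSet n
Sol C x = InOpenCube x × SatC C x

sumℚ : ∀ {k} → (Fin k → ℚ) → ℚ
sumℚ {zero} f = 0ℚ
sumℚ {suc k} f = f Fin.zero + sumℚ (λ i → f (Fin.suc i))

dot : ∀ {n} → Point n → Point n → ℚ
dot c x = sumℚ (λ i → c i * x i)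

record LinIneq (n : ℕ) : Set where
  constructor lineq
  field
    coeff : Point n
    bound : ℚ
    kind : Strictness

holdsLin : ∀ {n} → LinIneq n → Point n → Set
holdsLin (lineq c b weak) x = dot c x ≤ b
holdsLin (lineq c b strict) x = dot c x < b

numWeak : ∀ {n} → List (LinIneq n) → ℕ
numWeak [] = 0
numWeak (lineq _ _ weak ∷ L) = suc (numWeak L)
numWeak (lineq _ _ strict ∷ L) = numWeak L

AffinelyIndependent : ∀ {n k} → (Fin k → Point n) → Set
AffinelyIndependent {n} {k} p =
  (λc : Fin k → ℚ) → sumℚ λc ≡ 0ℚ →
  (∀ j → sumℚ (λ i → λc i * p i j) ≡ 0ℚ) → ∀ i → λc i ≡ 0ℚ

HasIndep : ∀ {n} → PSet n → ℕ → Set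
HasIndep {n} S k = Σ (Fin k → Point n) λ p → (∀ i → S (p i)) × AffinelyIndependent p

AffRank : ∀ {n} → PSet n → ℕ → Set
AffRank S k = HasIndep S k × ¬ HasIndep S (suc k)

HasDim : ∀ {n} → PSet n → ℕ → Set
HasDim S d = AffRank S (suc d)

Closure : ∀ {n} → PSet n → PSet n
Closure {n} S x = ∀ ε → 0ℚ < ε → Σ (Point n) λ y → S y × (∀ j → ∣ y j - x j ∣ < ε)

-- the inequality (in its weak form) is valid for S and the face of the
-- closure of S it cuts out has dimension d - 1, where dim S = d
FacetDefining : ∀ {n} → ℕ → PSet n → LinIneq n → Set
FacetDefining d S (lineq c b _) =
  (∀ x → S x → dot c x ≤ b) ×
  AffRank (λ x → Closure S x × (dot c x ≡ b)) d

AlmostOpen : ∀ {n} → ℕ → Conj n → Set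
AlmostOpen {n} d C =
  HasDim (Sol C) d ×
  Σ (List (LinIneq n)) λ L →
    (∀ x → Sol C x ⇔ All (λ l → holdsLin l x) L) ×
    All (FacetDefining d (Sol C)) L ×
    (numWeak L ℕ.≤ 1)

-- Φ given by its length ℓ and the block index blk a of each a ∈ [n]
record OSP (n : ℕ) : Set where
  constructor osp
  field
    len : ℕ
    blk : Fin n → Fin len
    surj : ∀ j → ∃ λ a → blk a ≡ j
open OSP public

IsDelta : ∀ {n} → Point n → OSP n → Set
IsDelta x Φ = ∀ a b → (blk Φ a ≡ blk Φ b → x a ≡ x b) × (blk Φ a Fin.< blk Φ b → x a < x b)

Simplex : ∀ {n} → OSP n → PSet n
Simplex Φ x = InOpenCube x × IsDelta x Φ

InK : ∀ {n} → Conj n → OSP n → Set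
InK C Φ = ∀ x → Simplex Φ x → Sol C x

-- Ψ refines Φ: each block of Φ is a union of consecutive blocks of Ψ
Refines : ∀ {n} → OSP n → OSP n → Set
Refines Ψ Φ = Σ (Fin (len Ψ) → Fin (len Φ)) λ g →
  (∀ i j → i Fin.≤ j → g i Fin.≤ g j) × (∀ a → blk Φ a ≡ g (blk Ψ a))

InInterval : ∀ {n} → OSP n × OSP n → OSP n → Set
InInterval I Φ = Refines (proj₂ I) Φ × Refines Φ (proj₁ I)

Partitionable : ∀ {n} → ℕ → Conj n → Set
Partitionable {n} d C =
  Σ ℕ λ m → Σ (Fin m → OSP n × OSP n) λ I →
    (∀ i → len (proj₂ (I i)) ≡ d) ×
    (∀ i → Refines (proj₂ (I i)) (proj₁ (I i))) ×
    (∀ i Φ → InInterval (I i) Φ → InK C Φ) ×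
    (∀ Φ → InK C Φ → ∃ λ i → InInterval (I i) Φ) ×
    (∀ Φ i j → InInterval (I i) Φ → InInterval (I j) Φ → i ≡ j)

-- Identify a face σ_Φ with its block labeling a ↦ (index of the block of a); it lies in C iff this
-- labeling satisfies C. Choose a strict total order ≺ on [n] with b ≺ a for every strict x_a < x_b
-- of C, and a ≺ b for every weak x_a ≤ x_b of C (a ≠ b) that is tight, i.e. x_a = x_b somewhere on
-- the polytope. Sorting each block of a face of C along ≺ yields a permutation face of C, and the
-- faces sorting to a permutation π are exactly those between π and the face whose blocks are the
-- ≺-ascending runs of π; these intervals partition the faces of C.
-- Such an order exists because almost openness leaves at most one tight weak inequality. If c is the
-- normal of the one weak linear inequality, then from every point of the polytope one can move a
-- little along any v with c·v ≤ 0 without leaving it. Hence a tight x_a ≤ x_b has P = c·(e_a − e_b) > 0,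
-- and moving from its tie along Q(e_a − e_b) − P(e_a′ − e_b′) shows 2Q ≤ P for every other pair
-- (a′, b′) with Q = c·(e_a′ − e_b′); two tight pairs would give both 2Q ≤ P and 2P ≤ Q.
-- Finally, permutation faces are n-dimensional, so d = n.

module Submission where

open import Defs

open import Data.Empty using (⊥; ⊥-elim)
open import Data.Fin as Fin using (Fin; toℕ; fromℕ<; punchIn; punchOut)
import Data.Fin.Properties as Fin
open import Data.List as List using (List; []; _∷_; length; filter; cartesianProductWith; allFin)
open import Data.List.Membership.Propositional using (_∈_; lose; find)
open import Data.List.Membership.Propositional.Properties
  using (∈-cartesianProductWith⁺; ∈-allFin; ∈-filter⁺; ∈-filter⁻; ∈-lookup)
open import Data.List.Relation.Unary.All as All using (All)
import Data.List.Relation.Unary.AllPairs as AllPairs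
open import Data.List.Relation.Unary.Any as Any using (here)
import Data.List.Relation.Unary.Any.Properties as Any
open import Data.List.Relation.Unary.Unique.Propositional using (Unique)
import Data.List.Relation.Unary.Unique.Propositional.Properties as Unique
open import Data.Nat as ℕ using (ℕ; zero; suc; _+_; _∸_; _≤_; _<_; z≤n; s≤s)
import Data.Nat.Properties as ℕ
open import Data.Product using (Σ; ∃; _×_; _,_; proj₁; proj₂)
open import Data.Product.Relation.Binary.Lex.Strict using (×-Lex; ×-isStrictTotalOrder)
open import Data.Product.Relation.Binary.Pointwise.NonDependent using (Pointwise)
open import Data.Rational as ℚ using (ℚ; 0ℚ; 1ℚ)
import Data.Rational.Properties as ℚ
open import Data.Rational.Solver using (module +-*-Solver)
open import Data.Sum as Sum using (_⊎_; inj₁; inj₂)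
open import Data.Unit using (⊤; tt)
open import Data.Vec as Vec using (Vec; []; _∷_)
import Data.Vec.Properties as Vec
open import Function using (_∘_; id; _⇔_; mk⇔; Equivalence)
open import Function.Properties.Equivalence using () renaming (sym to ⇔-sym; trans to ⇔-trans)
open import Level using (0ℓ)
open import Relation.Binary using (Rel; IsStrictTotalOrder; tri<; tri≈; tri>)
import Relation.Binary.Construct.Flip.EqAndOrd as Flip
open import Relation.Binary.Morphism using (IsOrderMonomorphism)
import Relation.Binary.Morphism.OrderMonomorphism as OrderMonomorphism
open import Relation.Binary.PropositionalEquality
open import Relation.Nullary using (Dec; yes; no; ¬_; contradiction; ¬?; _×-dec_)
open import Relation.Nullary.Decidable using (decidable-stable; from-yes; map′)
open import Relation.Unary using (Pred; Decidable; _⊆_)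

open +-*-Solver

count : ∀ {m} {P : Pred (Fin m) 0ℓ} → Decidable P → ℕ
count {zero} P? = 0
count {suc m} P? with P? Fin.zero
... | yes _ = suc (count (P? ∘ Fin.suc))
... | no _ = count (P? ∘ Fin.suc)

count-mono : ∀ {m} {P Q : Pred (Fin m) 0ℓ} (P? : Decidable P) (Q? : Decidable Q) →
  P ⊆ Q → count P? ≤ count Q?
count-mono {zero} _ _ _ = z≤n
count-mono {suc m} P? Q? P⊆Q with P? Fin.zero | Q? Fin.zero | count-mono (P? ∘ Fin.suc) (Q? ∘ Fin.suc) P⊆Q
... | yes _ | yes _ | ih = s≤s ih
... | yes p | no ¬q | _ = contradiction (P⊆Q p) ¬q
... | no _ | yes _ | ih = ℕ.m≤n⇒m≤1+n ih
... | no _ | no _ | ih = ih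

count-cong : ∀ {m} {P Q : Pred (Fin m) 0ℓ} (P? : Decidable P) (Q? : Decidable Q) →
  P ⊆ Q → Q ⊆ P → count P? ≡ count Q?
count-cong P? Q? P⊆Q Q⊆P = ℕ.≤-antisym (count-mono P? Q? P⊆Q) (count-mono Q? P? Q⊆P)

count-mono-< : ∀ {m} {P Q : Pred (Fin m) 0ℓ} (P? : Decidable P) (Q? : Decidable Q) →
  P ⊆ Q → ∀ j → ¬ P j → Q j → count P? < count Q?
count-mono-< {suc m} P? Q? P⊆Q Fin.zero ¬pj qj with P? Fin.zero | Q? Fin.zero
... | yes p | _ = contradiction p ¬pj
... | no _ | no ¬q = contradiction qj ¬q
... | no _ | yes _ = s≤s (count-mono (P? ∘ Fin.suc) (Q? ∘ Fin.suc) P⊆Q)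
count-mono-< {suc m} P? Q? P⊆Q (Fin.suc j) ¬pj qj
  with P? Fin.zero | Q? Fin.zero | count-mono-< (P? ∘ Fin.suc) (Q? ∘ Fin.suc) P⊆Q j ¬pj qj
... | yes _ | yes _ | ih = s≤s ih
... | yes p | no ¬q | _ = contradiction (P⊆Q p) ¬q
... | no _ | yes _ | ih = ℕ.m≤n⇒m≤1+n ih
... | no _ | no _ | ih = ih

count≤m : ∀ {m} {P : Pred (Fin m) 0ℓ} (P? : Decidable P) → count P? ≤ m
count≤m {zero} P? = z≤n
count≤m {suc m} P? with P? Fin.zero
... | yes _ = s≤s (count≤m (P? ∘ Fin.suc))
... | no _ = ℕ.m≤n⇒m≤1+n (count≤m (P? ∘ Fin.suc))

count<m : ∀ {m} {P : Pred (Fin m) 0ℓ} (P? : Decidable P) j → ¬ P j → count P? < m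
count<m {suc m} P? Fin.zero ¬pj with P? Fin.zero
... | yes p = contradiction p ¬pj
... | no _ = s≤s (count≤m (P? ∘ Fin.suc))
count<m {suc m} P? (Fin.suc j) ¬pj with P? Fin.zero
... | yes _ = s≤s (count<m (P? ∘ Fin.suc) j ¬pj)
... | no _ = ℕ.m≤n⇒m≤1+n (count<m (P? ∘ Fin.suc) j ¬pj)

count-none : ∀ {m} {P : Pred (Fin m) 0ℓ} (P? : Decidable P) → (∀ i → ¬ P i) → count P? ≡ 0
count-none {zero} P? _ = refl
count-none {suc m} P? none with P? Fin.zero
... | yes p = contradiction p (none Fin.zero)
... | no _ = count-none (P? ∘ Fin.suc) (none ∘ Fin.suc)

count-downClosed : ∀ {m} {P : Pred (Fin m) 0ℓ} (P? : Decidable P) →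
  (∀ {i j} → i Fin.≤ j → P j → P i) → ∀ q → P q ⇔ toℕ q < count P?
count-downClosed {suc m} P? down q with P? Fin.zero
count-downClosed {suc m} P? down Fin.zero | yes p₀ = mk⇔ (λ _ → s≤s z≤n) (λ _ → p₀)
count-downClosed {suc m} P? down (Fin.suc q) | yes _ =
  mk⇔ (s≤s ∘ Equivalence.to ih) (Equivalence.from ih ∘ ℕ.≤-pred)
  where ih = count-downClosed (P? ∘ Fin.suc) (λ i≤j → down (s≤s i≤j)) q
... | no ¬p₀ = mk⇔ (λ pq → contradiction (down z≤n pq) ¬p₀) (λ q<0 → contradiction (subst (toℕ q <_) none q<0) ℕ.n≮0)
  where none = count-none (P? ∘ Fin.suc) (λ i p → ¬p₀ (down z≤n p))

injective⇒surjective : ∀ {n} (π : Fin n → Fin n) → (∀ {a b} → π a ≡ π b → a ≡ b) → ∀ k → ∃ λ a → π a ≡ k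
injective⇒surjective π inj k with Fin.any? (λ a → π a Fin.≟ k)
... | yes found = found
injective⇒surjective {suc n} π inj k | no ¬found =
  contradiction (Fin.injective⇒≤ {f = π⁻k} (inj ∘ Fin.punchOut-injective (≢k _) (≢k _))) ℕ.1+n≰n
  where
  ≢k : ∀ a → k ≢ π a
  ≢k a k≡πa = ¬found (a , sym k≡πa)
  π⁻k : Fin (suc n) → Fin n
  π⁻k a = punchOut (≢k a)

Lex : ∀ {n} → (Fin n → ℕ) → Rel (Fin n) 0ℓ → Rel (Fin n) 0ℓ
Lex h _≺_ a b = h a < h b ⊎ (h a ≡ h b × a ≺ b)

Lex-resp-≗ : ∀ {n} {h h′ : Fin n → ℕ} {_≺_ : Rel (Fin n) 0ℓ} → h ≗ h′ → ∀ {a b} → Lex h _≺_ a b → Lex h′ _≺_ a b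
Lex-resp-≗ h≗h′ {a} {b} (inj₁ lt) = inj₁ (subst₂ _<_ (h≗h′ a) (h≗h′ b) lt)
Lex-resp-≗ h≗h′ {a} {b} (inj₂ (eq , a≺b)) = inj₂ (trans (sym (h≗h′ a)) (trans eq (h≗h′ b)) , a≺b)

Lex-isStrictTotalOrder : ∀ {n} (h : Fin n → ℕ) {_≺_ : Rel (Fin n) 0ℓ} →
  IsStrictTotalOrder _≡_ _≺_ → IsStrictTotalOrder _≡_ (Lex h _≺_)
Lex-isStrictTotalOrder h {_≺_} ≺-sto =
  OrderMonomorphism.isStrictTotalOrder key-mono (×-isStrictTotalOrder ℕ.<-isStrictTotalOrder ≺-sto)
  where
  key-mono : IsOrderMonomorphism _≡_ (Pointwise _≡_ _≡_) (Lex h _≺_) (×-Lex _≡_ _<_ _≺_) (λ a → h a , a)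
  key-mono = record
    { isOrderHomomorphism = record { cong = λ { refl → refl , refl } ; mono = id }
    ; injective = proj₂
    ; cancel = id
    }

index : ∀ {n} → OSP n → Fin n → ℕ
index Φ a = toℕ (blk Φ a)

rep : ∀ {n} (Φ : OSP n) → Fin (len Φ) → Fin n
rep Φ k = proj₁ (surj Φ k)

index-rep : ∀ {n} (Φ : OSP n) k → index Φ (rep Φ k) ≡ toℕ k
index-rep Φ k = cong toℕ (proj₂ (surj Φ k))

OrderedBy : ∀ {n} → OSP n → (Fin n → ℕ) → Set
OrderedBy Φ f = ∀ a b → index Φ a ≤ index Φ b ⇔ f a ≤ f b

orderedBy-sameBlock : ∀ {n} {Φ : OSP n} {f} → OrderedBy Φ f → ∀ {a b} → index Φ a ≡ index Φ b → f a ≡ f b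
orderedBy-sameBlock ord {a} {b} eq = ℕ.≤-antisym (Equivalence.to (ord a b) (ℕ.≤-reflexive eq))
                                                 (Equivalence.to (ord b a) (ℕ.≤-reflexive (sym eq)))

toℕ-punchIn-< : ∀ {m} (p : Fin (suc m)) (q : Fin m) → toℕ q < toℕ p → toℕ (punchIn p q) ≡ toℕ q
toℕ-punchIn-< (Fin.suc p) Fin.zero _ = refl
toℕ-punchIn-< (Fin.suc p) (Fin.suc q) (s≤s q<p) = cong suc (toℕ-punchIn-< p q q<p)

toℕ-punchIn-≥ : ∀ {m} (p : Fin (suc m)) (q : Fin m) → toℕ p ≤ toℕ q → toℕ (punchIn p q) ≡ suc (toℕ q)
toℕ-punchIn-≥ Fin.zero q _ = refl
toℕ-punchIn-≥ (Fin.suc p) (Fin.suc q) (s≤s p≤q) = cong suc (toℕ-punchIn-≥ p q p≤q)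

module ExtendOrdered {n} (f : Fin (suc n) → ℕ) (Φ : OSP n) (ord : OrderedBy Φ (f ∘ Fin.suc)) where

  joinBlock : ∀ i → f (Fin.suc i) ≡ f Fin.zero → Σ (OSP (suc n)) λ Ψ → OrderedBy Ψ f
  joinBlock i same = osp (len Φ) blk₀ surj₀ , ord₀
    where
    blk₀ : Fin (suc n) → Fin (len Φ)
    blk₀ Fin.zero = blk Φ i
    blk₀ (Fin.suc j) = blk Φ j
    surj₀ : ∀ k → ∃ λ a → blk₀ a ≡ k
    surj₀ k = Fin.suc (rep Φ k) , proj₂ (surj Φ k)
    ord₀ : OrderedBy (osp (len Φ) blk₀ surj₀) f
    ord₀ Fin.zero Fin.zero = mk⇔ (λ _ → ℕ.≤-refl) (λ _ → ℕ.≤-refl)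
    ord₀ Fin.zero (Fin.suc j) = subst (λ x → index Φ i ≤ index Φ j ⇔ x ≤ f (Fin.suc j)) same (ord i j)
    ord₀ (Fin.suc j) Fin.zero = subst (λ x → index Φ j ≤ index Φ i ⇔ f (Fin.suc j) ≤ x) same (ord j i)
    ord₀ (Fin.suc j) (Fin.suc k) = ord j k

  module NewBlock (fresh : ∀ i → f (Fin.suc i) ≢ f Fin.zero) where

    Below : Pred (Fin (len Φ)) 0ℓ
    Below k = f (Fin.suc (rep Φ k)) < f Fin.zero

    below? : Decidable Below
    below? k = f (Fin.suc (rep Φ k)) ℕ.<? f Fin.zero

    below-downClosed : ∀ {k k′} → k Fin.≤ k′ → Below k′ → Below k
    below-downClosed {k} {k′} k≤k′ =
      ℕ.≤-<-trans (Equivalence.to (ord _ _) (subst₂ _≤_ (sym (index-rep Φ k)) (sym (index-rep Φ k′)) k≤k′))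

    -- the new block is inserted right after the blocks whose values lie below f 0
    slot : Fin (suc (len Φ))
    slot = fromℕ< (s≤s (count≤m below?))

    below⇔ : ∀ j → index Φ j < toℕ slot ⇔ f (Fin.suc j) < f Fin.zero
    below⇔ j = subst₂ (λ t x → index Φ j < t ⇔ x < f Fin.zero) (sym (Fin.toℕ-fromℕ< _))
                      (orderedBy-sameBlock {Φ = Φ} ord (index-rep Φ (blk Φ j)))
                      (⇔-sym (count-downClosed below? below-downClosed (blk Φ j)))

    blk₀ : Fin (suc n) → Fin (suc (len Φ))
    blk₀ Fin.zero = slot
    blk₀ (Fin.suc j) = punchIn slot (blk Φ j)

    surj₀ : ∀ k → ∃ λ a → blk₀ a ≡ k
    surj₀ k with slot Fin.≟ k
    ... | yes slot≡k = Fin.zero , slot≡k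
    ... | no slot≢k = Fin.suc (rep Φ (punchOut slot≢k)) ,
                      trans (cong (punchIn slot) (proj₂ (surj Φ _))) (Fin.punchIn-punchOut slot≢k)

    slot≤old⇔ : ∀ j → toℕ slot ≤ toℕ (punchIn slot (blk Φ j)) ⇔ f Fin.zero ≤ f (Fin.suc j)
    slot≤old⇔ j with index Φ j ℕ.<? toℕ slot
    ... | yes j<slot = mk⇔ (λ slot≤j → contradiction (subst (toℕ slot ≤_) (toℕ-punchIn-< slot _ j<slot) slot≤j) (ℕ.<⇒≱ j<slot))
                           (λ x≤fj → contradiction (Equivalence.to (below⇔ j) j<slot) (ℕ.≤⇒≯ x≤fj))
    ... | no j≮slot = mk⇔ (λ _ → ℕ.≮⇒≥ (j≮slot ∘ Equivalence.from (below⇔ j)))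
                          (λ _ → subst (toℕ slot ≤_) (sym (toℕ-punchIn-≥ slot _ (ℕ.≮⇒≥ j≮slot))) (ℕ.m≤n⇒m≤1+n (ℕ.≮⇒≥ j≮slot)))

    old≤slot⇔ : ∀ j → toℕ (punchIn slot (blk Φ j)) ≤ toℕ slot ⇔ f (Fin.suc j) ≤ f Fin.zero
    old≤slot⇔ j with index Φ j ℕ.<? toℕ slot
    ... | yes j<slot = mk⇔ (λ _ → ℕ.<⇒≤ (Equivalence.to (below⇔ j) j<slot))
                           (λ _ → subst (_≤ toℕ slot) (sym (toℕ-punchIn-< slot _ j<slot)) (ℕ.<⇒≤ j<slot))
    ... | no j≮slot = mk⇔ (λ j≤slot → contradiction (subst (_≤ toℕ slot) (toℕ-punchIn-≥ slot _ (ℕ.≮⇒≥ j≮slot)) j≤slot)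
                                                    (ℕ.<⇒≱ (s≤s (ℕ.≮⇒≥ j≮slot))))
                          (λ fj≤x → contradiction (Equivalence.from (below⇔ j) (ℕ.≤∧≢⇒< fj≤x (fresh j))) j≮slot)

    ordered : OrderedBy (osp (suc (len Φ)) blk₀ surj₀) f
    ordered Fin.zero Fin.zero = mk⇔ (λ _ → ℕ.≤-refl) (λ _ → ℕ.≤-refl)
    ordered Fin.zero (Fin.suc j) = slot≤old⇔ j
    ordered (Fin.suc j) Fin.zero = old≤slot⇔ j
    ordered (Fin.suc j) (Fin.suc k) = mk⇔ (Equivalence.to (ord j k) ∘ Fin.punchIn-cancel-≤ slot _ _)
                                          (Fin.punchIn-mono-≤ slot _ _ ∘ Equivalence.from (ord j k))

  newBlock : (∀ i → f (Fin.suc i) ≢ f Fin.zero) → Σ (OSP (suc n)) λ Ψ → OrderedBy Ψ f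
  newBlock fresh = osp (suc (len Φ)) blk₀ surj₀ , ordered
    where open NewBlock fresh

ospOf : ∀ {n} (f : Fin n → ℕ) → Σ (OSP n) λ Φ → OrderedBy Φ f
ospOf {zero} f = osp 0 (λ ()) (λ ()) , λ ()
ospOf {suc n} f with ospOf (f ∘ Fin.suc) | Fin.any? (λ i → f (Fin.suc i) ℕ.≟ f Fin.zero)
... | Φ , ord | yes (i , same) = ExtendOrdered.joinBlock f Φ ord i same
... | Φ , ord | no ¬same = ExtendOrdered.newBlock f Φ ord (λ i same → ¬same (i , same))

_⊑_ : ∀ {n} → OSP n → OSP n → Set
Ψ ⊑ Φ = ∀ a b → index Ψ a ≤ index Ψ b → index Φ a ≤ index Φ b

refines⇒⊑ : ∀ {n} {Ψ Φ : OSP n} → Refines Ψ Φ → Ψ ⊑ Φ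
refines⇒⊑ {Φ = Φ} (g , g-mono , blkΦ≡g∘blkΨ) a b le =
  subst₂ (λ i j → toℕ i ≤ toℕ j) (sym (blkΦ≡g∘blkΨ a)) (sym (blkΦ≡g∘blkΨ b)) (g-mono _ _ le)

⊑⇒refines : ∀ {n} {Ψ Φ : OSP n} → Ψ ⊑ Φ → Refines Ψ Φ
⊑⇒refines {Ψ = Ψ} {Φ} Ψ⊑Φ = g , g-mono , blkΦ≡g∘blkΨ
  where
  g : Fin (len Ψ) → Fin (len Φ)
  g j = blk Φ (rep Ψ j)
  g-mono : ∀ i j → i Fin.≤ j → g i Fin.≤ g j
  g-mono i j i≤j = Ψ⊑Φ (rep Ψ i) (rep Ψ j) (subst₂ _≤_ (sym (index-rep Ψ i)) (sym (index-rep Ψ j)) i≤j)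
  blkΦ≡g∘blkΨ : ∀ a → blk Φ a ≡ g (blk Ψ a)
  blkΦ≡g∘blkΨ a = Fin.toℕ-injective (ℕ.≤-antisym (Ψ⊑Φ a _ (ℕ.≤-reflexive (sym (index-rep Ψ (blk Ψ a)))))
                                                 (Ψ⊑Φ _ a (ℕ.≤-reflexive (index-rep Ψ (blk Ψ a)))))

Labeling : ℕ → Set
Labeling n = Fin n → ℕ

holdsℕ : ∀ {n} → BasicIneq n → Labeling n → Set
holdsℕ (bineq a b weak) h = h a ≤ h b
holdsℕ (bineq a b strict) h = h a < h b

Satisfies : ∀ {n} → Conj n → Labeling n → Set
Satisfies C h = All (λ ι → holdsℕ ι h) C

satisfies? : ∀ {n} (C : Conj n) h → Dec (Satisfies C h)
satisfies? C h = All.all? holdsℕ? C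
  where
  holdsℕ? : ∀ ι → Dec (holdsℕ ι h)
  holdsℕ? (bineq a b weak) = h a ℕ.≤? h b
  holdsℕ? (bineq a b strict) = h a ℕ.<? h b

mapIneq : ∀ {n} {P Q : Pred (BasicIneq n) 0ℓ} →
  (∀ {a b} → P (bineq a b weak) → Q (bineq a b weak)) →
  (∀ {a b} → P (bineq a b strict) → Q (bineq a b strict)) →
  ∀ {C} → All P C → All Q C
mapIneq onWeak onStrict = All.map λ { {bineq a b weak} → onWeak ; {bineq a b strict} → onStrict }

tabulateIneq : ∀ {n} {C : Conj n} {Q : Pred (BasicIneq n) 0ℓ} →
  (∀ {a b} → bineq a b weak ∈ C → Q (bineq a b weak)) →
  (∀ {a b} → bineq a b strict ∈ C → Q (bineq a b strict)) →
  All Q C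
tabulateIneq onWeak onStrict = All.tabulate λ { {bineq a b weak} → onWeak ; {bineq a b strict} → onStrict }

Satisfies-resp-≗ : ∀ {n} {C : Conj n} {h h′ : Labeling n} → h ≗ h′ → Satisfies C h → Satisfies C h′
Satisfies-resp-≗ h≗h′ = mapIneq (subst₂ _≤_ (h≗h′ _) (h≗h′ _)) (subst₂ _<_ (h≗h′ _) (h≗h′ _))

ℚ-≤⇒≯ : ∀ {p q} → p ℚ.≤ q → ¬ q ℚ.< p
ℚ-≤⇒≯ p≤q q<p = ℚ.<-irrefl refl (ℚ.<-≤-trans q<p p≤q)

ℚ-*-cancelˡ-≡0 : ∀ r .{{_ : ℚ.Positive r}} {x} → r ℚ.* x ≡ 0ℚ → x ≡ 0ℚ
ℚ-*-cancelˡ-≡0 r rx≡0 = ℚ.≤-antisym (ℚ.*-cancelˡ-≤-pos r (ℚ.≤-reflexive (trans rx≡0 (sym (ℚ.*-zeroʳ r)))))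
                                    (ℚ.*-cancelˡ-≤-pos r (ℚ.≤-reflexive (trans (ℚ.*-zeroʳ r) (sym rx≡0))))

ℚ-≤-translate : ∀ {x y} z {x′ y′} → x ℚ.+ z ≡ x′ → y ℚ.+ z ≡ y′ → x ℚ.≤ y → x′ ℚ.≤ y′
ℚ-≤-translate z x+z≡x′ y+z≡y′ x≤y = subst₂ ℚ._≤_ x+z≡x′ y+z≡y′ (ℚ.+-monoˡ-≤ z x≤y)

ofℕ : ℕ → ℚ
ofℕ zero = 0ℚ
ofℕ (suc k) = 1ℚ ℚ.+ ofℕ k

ofℕ-+ : ∀ m k → ofℕ (m + k) ≡ ofℕ m ℚ.+ ofℕ k
ofℕ-+ zero k = sym (ℚ.+-identityˡ (ofℕ k))
ofℕ-+ (suc m) k = trans (cong (1ℚ ℚ.+_) (ofℕ-+ m k)) (sym (ℚ.+-assoc 1ℚ (ofℕ m) (ofℕ k)))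

ofℕ-<-suc : ∀ k → ofℕ k ℚ.< ofℕ (suc k)
ofℕ-<-suc k = subst (ℚ._< ofℕ (suc k)) (ℚ.+-identityˡ (ofℕ k)) (ℚ.+-monoˡ-< (ofℕ k) (ℚ.positive⁻¹ 1ℚ))

ofℕ-mono-< : ∀ {m k} → m < k → ofℕ m ℚ.< ofℕ k
ofℕ-mono-< {m} {suc k} (s≤s m≤k) with ℕ.m≤n⇒m<n∨m≡n m≤k
... | inj₁ m<k = ℚ.<-trans (ofℕ-mono-< m<k) (ofℕ-<-suc k)
... | inj₂ refl = ofℕ-<-suc m

ofℕ-mono-≤ : ∀ {m k} → m ≤ k → ofℕ m ℚ.≤ ofℕ k
ofℕ-mono-≤ m≤k with ℕ.m≤n⇒m<n∨m≡n m≤k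
... | inj₁ m<k = ℚ.<⇒≤ (ofℕ-mono-< m<k)
... | inj₂ refl = ℚ.≤-refl

ofℕ-cancel-≤ : ∀ {m k} → ofℕ m ℚ.≤ ofℕ k → m ≤ k
ofℕ-cancel-≤ le = ℕ.≮⇒≥ (ℚ-≤⇒≯ le ∘ ofℕ-mono-<)

ofℕ-cancel-< : ∀ {m k} → ofℕ m ℚ.< ofℕ k → m < k
ofℕ-cancel-< lt = ℕ.≰⇒> (λ k≤m → ℚ-≤⇒≯ (ofℕ-mono-≤ k≤m) lt)

ofℕ-suc-positive : ∀ k → ℚ.Positive (ofℕ (suc k))
ofℕ-suc-positive k = ℚ.positive (ofℕ-mono-< {0} {suc k} (s≤s z≤n))

scale : ℕ → ℚ
scale N = (ℚ.1/ ofℕ (2 + N)) {{ℚ.pos⇒nonZero (ofℕ (2 + N)) {{ofℕ-suc-positive (suc N)}}}}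

scale-positive : ∀ N → ℚ.Positive (scale N)
scale-positive N = ℚ.1/pos⇒pos (ofℕ (2 + N)) {{ofℕ-suc-positive (suc N)}}

ofℕ*scale : ∀ N → ofℕ (2 + N) ℚ.* scale N ≡ 1ℚ
ofℕ*scale N = ℚ.*-inverseʳ (ofℕ (2 + N)) {{ℚ.pos⇒nonZero (ofℕ (2 + N)) {{ofℕ-suc-positive (suc N)}}}}

realise : ∀ {n} → ℕ → Labeling n → Point n
realise N h a = ofℕ (suc (h a)) ℚ.* scale N

module _ {n} (N : ℕ) (h : Labeling n) where
  private instance
    scale>0 : ℚ.Positive (scale N)
    scale>0 = scale-positive N

  realise-mono-< : ∀ {a b} → h a < h b → realise N h a ℚ.< realise N h b
  realise-mono-< = ℚ.*-monoˡ-<-pos (scale N) ∘ ofℕ-mono-< ∘ s≤s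

  realise-mono-≤ : ∀ {a b} → h a ≤ h b → realise N h a ℚ.≤ realise N h b
  realise-mono-≤ = ℚ.*-monoʳ-≤-nonNeg (scale N) {{ℚ.pos⇒nonNeg (scale N)}} ∘ ofℕ-mono-≤ ∘ s≤s

  realise-cancel-< : ∀ {a b} → realise N h a ℚ.< realise N h b → h a < h b
  realise-cancel-< = ℕ.≤-pred ∘ ofℕ-cancel-< ∘ ℚ.*-cancelʳ-<-nonNeg (scale N) {{ℚ.pos⇒nonNeg (scale N)}}

  realise-cancel-≤ : ∀ {a b} → realise N h a ℚ.≤ realise N h b → h a ≤ h b
  realise-cancel-≤ = ℕ.≤-pred ∘ ofℕ-cancel-≤ ∘ ℚ.*-cancelʳ-≤-pos (scale N)

  realise-inCube : (∀ a → h a ≤ N) → InOpenCube (realise N h)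
  realise-inCube h≤N a = above0 , below1
    where
    above0 : 0ℚ ℚ.< realise N h a
    above0 = subst (ℚ._< realise N h a) (ℚ.*-zeroˡ (scale N)) (ℚ.*-monoˡ-<-pos (scale N) (ofℕ-mono-< {0} {suc (h a)} (s≤s z≤n)))
    below1 : realise N h a ℚ.< 1ℚ
    below1 = subst (realise N h a ℚ.<_) (ofℕ*scale N) (ℚ.*-monoˡ-<-pos (scale N) (ofℕ-mono-< (s≤s (s≤s (h≤N a)))))

  realise-sol : ∀ {C} → (∀ a → h a ≤ N) → Satisfies C h → Sol C (realise N h)
  realise-sol h≤N sat = realise-inCube h≤N , mapIneq realise-mono-≤ realise-mono-< sat

  realise-sol⁻ : ∀ {C} → Sol C (realise N h) → Satisfies C h
  realise-sol⁻ (_ , sat) = mapIneq realise-cancel-≤ realise-cancel-< sat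

labelBound : ∀ {n} → Labeling n → ℕ
labelBound {zero} h = 0
labelBound {suc n} h = h Fin.zero ℕ.⊔ labelBound (h ∘ Fin.suc)

labelBound-≥ : ∀ {n} (h : Labeling n) a → h a ≤ labelBound h
labelBound-≥ h Fin.zero = ℕ.m≤m⊔n _ _
labelBound-≥ h (Fin.suc a) = ℕ.≤-trans (labelBound-≥ (h ∘ Fin.suc) a) (ℕ.m≤n⊔m (h Fin.zero) _)

point : ∀ {n} → Labeling n → Point n
point h = realise (labelBound h) h

point-sol : ∀ {n} {C : Conj n} {h} → Satisfies C h → Sol C (point h)
point-sol {h = h} = realise-sol (labelBound h) h (labelBound-≥ h)

point-tie : ∀ {n} (h : Labeling n) {a b} → h a ≡ h b → point h a ≡ point h b
point-tie h = cong (λ k → ofℕ (suc k) ℚ.* scale (labelBound h))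

inK⇒satisfies : ∀ {n} {C : Conj n} (Φ : OSP n) → InK C Φ → Satisfies C (index Φ)
inK⇒satisfies Φ inK = realise-sol⁻ (labelBound (index Φ)) (index Φ) (inK (point (index Φ)) (inCube , isDelta))
  where
  inCube = realise-inCube (labelBound (index Φ)) (index Φ) (labelBound-≥ (index Φ))
  isDelta : IsDelta (point (index Φ)) Φ
  isDelta a b = point-tie (index Φ) ∘ cong toℕ , realise-mono-< (labelBound (index Φ)) (index Φ)

satisfies⇒inK : ∀ {n} {C : Conj n} (Φ : OSP n) → Satisfies C (index Φ) → InK C Φ
satisfies⇒inK Φ sat x (inCube , isDelta) = inCube , mapIneq weakly strictly sat
  where
  weakly : ∀ {a b} → index Φ a ≤ index Φ b → x a ℚ.≤ x b
  weakly {a} {b} le with ℕ.m≤n⇒m<n∨m≡n le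
  ... | inj₁ lt = ℚ.<⇒≤ (proj₂ (isDelta a b) lt)
  ... | inj₂ eq = ℚ.≤-reflexive (proj₁ (isDelta a b) (Fin.toℕ-injective eq))
  strictly : ∀ {a b} → index Φ a < index Φ b → x a ℚ.< x b
  strictly {a} {b} = proj₂ (isDelta a b)

rank : ∀ {n} → Point n → Fin n → Fin n
rank y a = fromℕ< (count<m (λ c → y c ℚ.<? y a) a (ℚ.<-irrefl refl))

toℕ-rank : ∀ {n} (y : Point n) a → toℕ (rank y a) ≡ count (λ c → y c ℚ.<? y a)
toℕ-rank y a = Fin.toℕ-fromℕ< _

rank-sat : ∀ {n} {C : Conj n} (y : Point n) → SatC C y → Satisfies C (toℕ ∘ rank y)
rank-sat y = mapIneq weakly strictly
  where
  weakly : ∀ {a b} → y a ℚ.≤ y b → toℕ (rank y a) ≤ toℕ (rank y b)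
  weakly {a} {b} le = subst₂ _≤_ (sym (toℕ-rank y a)) (sym (toℕ-rank y b))
    (count-mono (λ c → y c ℚ.<? y a) (λ c → y c ℚ.<? y b) (λ lt → ℚ.<-≤-trans lt le))
  strictly : ∀ {a b} → y a ℚ.< y b → toℕ (rank y a) < toℕ (rank y b)
  strictly {a} {b} lt = subst₂ _<_ (sym (toℕ-rank y a)) (sym (toℕ-rank y b))
    (count-mono-< (λ c → y c ℚ.<? y a) (λ c → y c ℚ.<? y b) (λ lt′ → ℚ.<-trans lt′ lt) a (ℚ.<-irrefl refl) lt)

rank-tie : ∀ {n} (y : Point n) {a b} → y a ≡ y b → rank y a ≡ rank y b
rank-tie y {a} {b} ya≡yb = Fin.toℕ-injective (begin
  toℕ (rank y a)                   ≡⟨ toℕ-rank y a ⟩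
  count (λ c → y c ℚ.<? y a)       ≡⟨ cong (λ t → count (λ c → y c ℚ.<? t)) ya≡yb ⟩
  count (λ c → y c ℚ.<? y b)       ≡⟨ toℕ-rank y b ⟨
  toℕ (rank y b)                   ∎)
  where open ≡-Reasoning

Tight : ∀ {n} → Conj n → Fin n → Fin n → Set
Tight C a b = ∃ λ y → Sol C y × y a ≡ y b

TightEdge : ∀ {n} → Conj n → Fin n → Fin n → Set
TightEdge C a b = bineq a b weak ∈ C × a ≢ b × Tight C a b

labels : ∀ {n m} → Vec (Fin m) n → Labeling n
labels v = toℕ ∘ Vec.lookup v

allVecs : ∀ n m → List (Vec (Fin m) n)
allVecs zero m = [] ∷ []
allVecs (suc n) m = cartesianProductWith _∷_ (allFin m) (allVecs n m)

allVecs-complete : ∀ {n m} (v : Vec (Fin m) n) → v ∈ allVecs n m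
allVecs-complete [] = here refl
allVecs-complete (x ∷ v) = ∈-cartesianProductWith⁺ _∷_ (∈-allFin x) (allVecs-complete v)

allVecs-unique : ∀ n m → Unique (allVecs n m)
allVecs-unique zero m = All.[] AllPairs.∷ AllPairs.[]
allVecs-unique (suc n) m = Unique.cartesianProductWith⁺ _∷_ Vec.∷-injective (Unique.allFin⁺ m) (allVecs-unique n m)

Unique-lookup-injective : ∀ {A : Set} {xs : List A} → Unique xs → ∀ {i j} → List.lookup xs i ≡ List.lookup xs j → i ≡ j
Unique-lookup-injective (_ AllPairs.∷ _) {Fin.zero} {Fin.zero} _ = refl
Unique-lookup-injective (x∉ AllPairs.∷ _) {Fin.zero} {Fin.suc j} eq = contradiction eq (All.lookup x∉ (∈-lookup j))
Unique-lookup-injective (x∉ AllPairs.∷ _) {Fin.suc i} {Fin.zero} eq = contradiction (sym eq) (All.lookup x∉ (∈-lookup i))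
Unique-lookup-injective (_ AllPairs.∷ u) {Fin.suc i} {Fin.suc j} eq = cong Fin.suc (Unique-lookup-injective u eq)

lookup-≗⇒≡ : ∀ {A : Set} {n} {u v : Vec A n} → Vec.lookup u ≗ Vec.lookup v → u ≡ v
lookup-≗⇒≡ {u = u} {v} u≗v = trans (sym (Vec.tabulate∘lookup u)) (trans (Vec.tabulate-cong u≗v) (Vec.tabulate∘lookup v))

-- A tie at a point of the polytope is already a tie of the face through it, and faces are finitely many.
tight? : ∀ {n} (C : Conj n) a b → Dec (Tight C a b)
tight? {n} C a b = map′ fromLabels toLabels (Any.any? tiedLabels? (allVecs n n))
  where
  TiedLabels : Vec (Fin n) n → Set
  TiedLabels v = Satisfies C (labels v) × Vec.lookup v a ≡ Vec.lookup v b
  tiedLabels? : ∀ v → Dec (TiedLabels v)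
  tiedLabels? v = satisfies? C (labels v) ×-dec (Vec.lookup v a Fin.≟ Vec.lookup v b)
  fromLabels : Any.Any TiedLabels (allVecs n n) → Tight C a b
  fromLabels tied with Any.satisfied tied
  ... | v , sat , tie = point (labels v) , point-sol sat , point-tie (labels v) (cong toℕ tie)
  toLabels : Tight C a b → Any.Any TiedLabels (allVecs n n)
  toLabels (y , sol , tie) = lose (allVecs-complete v) (sat , lookup-tie)
    where
    v = Vec.tabulate (rank y)
    sat : Satisfies C (labels v)
    sat = Satisfies-resp-≗ {h = toℕ ∘ rank y} (λ c → cong toℕ (sym (Vec.lookup∘tabulate (rank y) c))) (rank-sat y (proj₂ sol))
    lookup-tie : Vec.lookup v a ≡ Vec.lookup v b
    lookup-tie = trans (Vec.lookup∘tabulate (rank y) a) (trans (rank-tie y tie) (sym (Vec.lookup∘tabulate (rank y) b)))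

module Shelling {n} (C : Conj n) {_≺_ : Rel (Fin n) 0ℓ} (≺-sto : IsStrictTotalOrder _≡_ _≺_)
  (strict⇒≻ : ∀ {a b} → bineq a b strict ∈ C → b ≺ a)
  (tight⇒≺ : ∀ {a b} → TightEdge C a b → a ≺ b)
  where

  module ≺ = IsStrictTotalOrder ≺-sto
  module LexOrder (h : Labeling n) = IsStrictTotalOrder (Lex-isStrictTotalOrder h ≺-sto)

  sortRank : Labeling n → Labeling n
  sortRank h a = count (λ c → LexOrder._<?_ h c a)

  sortRank<n : ∀ h a → sortRank h a < n
  sortRank<n h a = count<m _ a (LexOrder.irrefl h refl)

  sortRank-mono : ∀ h {a b} → Lex h _≺_ a b → sortRank h a < sortRank h b
  sortRank-mono h {a} a<b = count-mono-< _ _ (λ c<a → LexOrder.trans h c<a a<b) a (LexOrder.irrefl h refl) a<b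

  sortRank-cancel : ∀ h {a b} → sortRank h a < sortRank h b → Lex h _≺_ a b
  sortRank-cancel h {a} {b} lt with LexOrder.compare h a b
  ... | tri< a<b _ _ = a<b
  ... | tri≈ _ refl _ = contradiction lt (ℕ.<-irrefl refl)
  ... | tri> _ _ b<a = contradiction lt (ℕ.<-asym (sortRank-mono h b<a))

  sortRank-injective : ∀ h {a b} → sortRank h a ≡ sortRank h b → a ≡ b
  sortRank-injective h {a} {b} eq with LexOrder.compare h a b
  ... | tri< a<b _ _ = contradiction eq (ℕ.<⇒≢ (sortRank-mono h a<b))
  ... | tri≈ _ a≡b _ = a≡b
  ... | tri> _ _ b<a = contradiction (sym eq) (ℕ.<⇒≢ (sortRank-mono h b<a))

  sortRank-cong : ∀ {h h′} → (∀ c a → Lex h _≺_ c a ⇔ Lex h′ _≺_ c a) → ∀ a → sortRank h a ≡ sortRank h′ a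
  sortRank-cong {h} {h′} h⇔h′ a = count-cong (λ c → LexOrder._<?_ h c a) (λ c → LexOrder._<?_ h′ c a)
                                             (Equivalence.to (h⇔h′ _ a)) (Equivalence.from (h⇔h′ _ a))

  Lex-injective : ∀ {h} → (∀ {a b} → h a ≡ h b → a ≡ b) → ∀ c a → Lex h _≺_ c a ⇔ h c < h a
  Lex-injective h-inj c a = mk⇔ (λ { (inj₁ lt) → lt ; (inj₂ (eq , c≺a)) → contradiction c≺a (≺.irrefl (h-inj eq)) }) inj₁

  -- For p = toℕ ∘ π with π : Fin n → Fin n this says that π is a permutation, in a form that is
  -- decidable and can be compared with sortRank without counting bijections.
  Sorted : Labeling n → Set
  Sorted p = ∀ a → p a ≡ sortRank p a

  sorted? : ∀ p → Dec (Sorted p)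
  sorted? p = Fin.all? (λ a → p a ℕ.≟ sortRank p a)

  sorted-injective : ∀ {p} → Sorted p → ∀ {a b} → p a ≡ p b → a ≡ b
  sorted-injective {p} p-sorted {a} {b} eq = sortRank-injective p (trans (sym (p-sorted a)) (trans eq (p-sorted b)))

  sortRank-sorted : ∀ h → Sorted (sortRank h)
  sortRank-sorted h a = sortRank-cong (λ c a → ⇔-trans (mk⇔ (sortRank-mono h) (sortRank-cancel h))
                                                          (⇔-sym (Lex-injective (sortRank-injective h) c a))) a

  Sorted-resp-≗ : ∀ {p q} → p ≗ q → Sorted p → Sorted q
  Sorted-resp-≗ {p} {q} p≗q p-sorted a = begin
    q a            ≡⟨ p≗q a ⟨
    p a            ≡⟨ p-sorted a ⟩
    sortRank p a   ≡⟨ sortRank-cong (λ c a → mk⇔ (Lex-resp-≗ {_≺_ = _≺_} p≗q) (Lex-resp-≗ {_≺_ = _≺_} (sym ∘ p≗q))) a ⟩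
    sortRank q a   ∎
    where open ≡-Reasoning

  sort : Labeling n → Fin n → Fin n
  sort h a = fromℕ< (sortRank<n h a)

  toℕ-sort : ∀ h → toℕ ∘ sort h ≗ sortRank h
  toℕ-sort h a = Fin.toℕ-fromℕ< (sortRank<n h a)

  sortRank-sat : ∀ h → Satisfies C h → Satisfies C (sortRank h)
  sortRank-sat h sat = tabulateIneq weakly (λ mem → sortRank-mono h (inj₁ (All.lookup sat mem)))
    where
    weakly : ∀ {a b} → bineq a b weak ∈ C → sortRank h a ≤ sortRank h b
    weakly {a} {b} mem with ℕ.m≤n⇒m<n∨m≡n (All.lookup sat mem) | a Fin.≟ b
    ... | inj₁ lt | _ = ℕ.<⇒≤ (sortRank-mono h (inj₁ lt))
    ... | inj₂ _ | yes refl = ℕ.≤-refl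
    ... | inj₂ eq | no a≢b = ℕ.<⇒≤ (sortRank-mono h (inj₂ (eq , tight⇒≺ (mem , a≢b , point h , point-sol sat , point-tie h eq))))

  sort-surjective : ∀ h k → ∃ λ a → sort h a ≡ k
  sort-surjective h = injective⇒surjective (sort h) λ {a} {b} eq →
    sortRank-injective h (trans (sym (toℕ-sort h a)) (trans (cong toℕ eq) (toℕ-sort h b)))

  sort-sat : ∀ h → Satisfies C h → Satisfies C (toℕ ∘ sort h)
  sort-sat h = Satisfies-resp-≗ {h = sortRank h} (sym ∘ toℕ-sort h) ∘ sortRank-sat h

  module Interval (π : Fin n → Fin n) (π-sorted : Sorted (toℕ ∘ π)) (π-sat : Satisfies C (toℕ ∘ π)) where

    pos : Labeling n
    pos = toℕ ∘ π

    pos-injective : ∀ {a b} → pos a ≡ pos b → a ≡ b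
    pos-injective = sorted-injective π-sorted

    π-surjective : ∀ k → ∃ λ a → π a ≡ k
    π-surjective = injective⇒surjective π (pos-injective ∘ cong toℕ)

    Ascent : Fin n → Set
    Ascent c = ∃ λ c′ → pos c′ ≡ suc (pos c) × c ≺ c′

    ascent? : ∀ c → Dec (Ascent c)
    ascent? c = Fin.any? (λ c′ → (pos c′ ℕ.≟ suc (pos c)) ×-dec (c ≺.<? c′))

    DescentBefore : Fin n → Pred (Fin n) 0ℓ
    DescentBefore a c = pos c < pos a × ¬ Ascent c

    descentBefore? : ∀ a → Decidable (DescentBefore a)
    descentBefore? a c = (pos c ℕ.<? pos a) ×-dec (¬? (ascent? c))

    -- the index of the maximal ≺-ascending run of π that contains a
    run : Labeling n
    run a = count (descentBefore? a)

    run-mono : ∀ {a b} → pos a ≤ pos b → run a ≤ run b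
    run-mono {a} {b} a≤b =
      count-mono (descentBefore? a) (descentBefore? b) (λ (c<a , ¬asc) → ℕ.<-≤-trans c<a a≤b , ¬asc)

    run-mono-< : ∀ {a b} → pos a < pos b → ¬ Ascent a → run a < run b
    run-mono-< {a} {b} a<b ¬asc = count-mono-< (descentBefore? a) (descentBefore? b)
      (λ (c<a , ¬asc) → ℕ.<-trans c<a a<b , ¬asc) a (ℕ.<-irrefl refl ∘ proj₁) (a<b , ¬asc)

    sameRun⇒≺ : ∀ k {a b} → pos b ≡ k + pos a → run a ≡ run b → a ≡ b ⊎ a ≺ b
    sameRun⇒≺ zero b≡a _ = inj₁ (pos-injective (sym b≡a))
    sameRun⇒≺ (suc k) {a} {b} b≡k+1+a ra≡rb with ascent? a
    ... | no ¬asc = contradiction ra≡rb (ℕ.<⇒≢ (run-mono-< (subst (pos a <_) (sym b≡k+1+a) (ℕ.m<n+m (pos a) (s≤s z≤n))) ¬asc))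
    ... | yes (c , c≡a+1 , a≺c) with sameRun⇒≺ k b≡k+c rc≡rb
      where
      b≡k+c : pos b ≡ k + pos c
      b≡k+c = trans b≡k+1+a (trans (sym (ℕ.+-suc k (pos a))) (cong (k +_) (sym c≡a+1)))
      rc≡rb : run c ≡ run b
      rc≡rb = ℕ.≤-antisym (run-mono (subst (pos c ≤_) (sym b≡k+c) (ℕ.m≤n+m (pos c) k)))
                          (subst (_≤ run c) ra≡rb (run-mono (subst (pos a ≤_) (sym c≡a+1) (ℕ.n≤1+n (pos a)))))
    ... | inj₁ refl = inj₂ a≺c
    ... | inj₂ c≺b = inj₂ (≺.trans a≺c c≺b)

    sameRun⇒≼ : ∀ {a b} → pos a ≤ pos b → run a ≡ run b → a ≡ b ⊎ a ≺ b
    sameRun⇒≼ {a} {b} a≤b = sameRun⇒≺ (pos b ∸ pos a) (sym (ℕ.m∸n+n≡m a≤b))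

    ascents⇒sameRun : ∀ {a b} → pos a ≤ pos b → (∀ c → pos a ≤ pos c → pos c < pos b → Ascent c) → run a ≡ run b
    ascents⇒sameRun {a} {b} a≤b ascents =
      count-cong (descentBefore? a) (descentBefore? b) (λ (c<a , ¬asc) → ℕ.<-≤-trans c<a a≤b , ¬asc) below-a
      where
      below-a : DescentBefore b ⊆ DescentBefore a
      below-a {c} (c<b , ¬asc) = ℕ.≰⇒> (λ a≤c → ¬asc (ascents c a≤c c<b)) , ¬asc

    finest : OSP n
    finest = osp n π π-surjective

    coarsest : OSP n
    coarsest = proj₁ (ospOf run)

    coarsest-≤ : ∀ {a b} → run a ≤ run b → index coarsest a ≤ index coarsest b
    coarsest-≤ = Equivalence.from (proj₂ (ospOf run) _ _)

    coarsest-≤⁻ : ∀ {a b} → index coarsest a ≤ index coarsest b → run a ≤ run b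
    coarsest-≤⁻ = Equivalence.to (proj₂ (ospOf run) _ _)

    finest-refines-coarsest : Refines finest coarsest
    finest-refines-coarsest = ⊑⇒refines {Ψ = finest} {coarsest} (λ a b → coarsest-≤ ∘ run-mono)

    module InInterval {Φ : OSP n} (finest-refines-Φ : Refines finest Φ) (Φ-refines-coarsest : Refines Φ coarsest) where

      finest⊑Φ : finest ⊑ Φ
      finest⊑Φ = refines⇒⊑ {Ψ = finest} {Φ} finest-refines-Φ

      Φ⊑coarsest : Φ ⊑ coarsest
      Φ⊑coarsest = refines⇒⊑ {Ψ = Φ} {coarsest} Φ-refines-coarsest

      sameBlock⇒sameRun : ∀ {a b} → index Φ a ≡ index Φ b → run a ≡ run b
      sameBlock⇒sameRun {a} {b} eq = ℕ.≤-antisym (coarsest-≤⁻ (Φ⊑coarsest a b (ℕ.≤-reflexive eq)))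
                                                (coarsest-≤⁻ (Φ⊑coarsest b a (ℕ.≤-reflexive (sym eq))))

      Lex⇔pos< : ∀ c a → Lex (index Φ) _≺_ c a ⇔ pos c < pos a
      Lex⇔pos< c a = mk⇔ to from
        where
        to : Lex (index Φ) _≺_ c a → pos c < pos a
        to (inj₁ c<a) = ℕ.≰⇒> (λ a≤c → ℕ.<⇒≱ c<a (finest⊑Φ a c a≤c))
        to (inj₂ (eq , c≺a)) = ℕ.≰⇒> λ a≤c → case (sameRun⇒≼ a≤c (sameBlock⇒sameRun (sym eq)))
          where
          case : a ≡ c ⊎ a ≺ c → ⊥
          case (inj₁ refl) = ≺.irrefl refl c≺a
          case (inj₂ a≺c) = ≺.asym a≺c c≺a
        from : pos c < pos a → Lex (index Φ) _≺_ c a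
        from c<a with index Φ c ℕ.<? index Φ a
        ... | yes lt = inj₁ lt
        ... | no ≮ = sameBlock (ℕ.≤-antisym (finest⊑Φ c a (ℕ.<⇒≤ c<a)) (ℕ.≮⇒≥ ≮))
          where
          sameBlock : index Φ c ≡ index Φ a → Lex (index Φ) _≺_ c a
          sameBlock eq with sameRun⇒≼ (ℕ.<⇒≤ c<a) (sameBlock⇒sameRun eq)
          ... | inj₁ refl = contradiction c<a (ℕ.<-irrefl refl)
          ... | inj₂ c≺a = inj₂ (eq , c≺a)

      interval-sorted : pos ≗ sortRank (index Φ)
      interval-sorted a = trans (π-sorted a) (sortRank-cong (λ c a →
        ⇔-trans (Lex-injective pos-injective c a) (⇔-sym (Lex⇔pos< c a))) a)

      interval-sat : Satisfies C (index Φ)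
      interval-sat = tabulateIneq (λ mem → finest⊑Φ _ _ (All.lookup π-sat mem)) strictly
        where
        strictly : ∀ {a b} → bineq a b strict ∈ C → index Φ a < index Φ b
        strictly mem with Equivalence.from (Lex⇔pos< _ _) (All.lookup π-sat mem)
        ... | inj₁ lt = lt
        ... | inj₂ (_ , a≺b) = contradiction (strict⇒≻ mem) (≺.asym a≺b)

    module SortedBy {Φ : OSP n} (pos≗sortRank : pos ≗ sortRank (index Φ)) where

      Lex⇒pos< : ∀ {a b} → Lex (index Φ) _≺_ a b → pos a < pos b
      Lex⇒pos< {a} {b} = subst₂ _<_ (sym (pos≗sortRank a)) (sym (pos≗sortRank b)) ∘ sortRank-mono (index Φ)

      pos<⇒Lex : ∀ {a b} → pos a < pos b → Lex (index Φ) _≺_ a b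
      pos<⇒Lex {a} {b} = sortRank-cancel (index Φ) ∘ subst₂ _<_ (pos≗sortRank a) (pos≗sortRank b)

      finest⊑Φ : finest ⊑ Φ
      finest⊑Φ a b a≤b = ℕ.≮⇒≥ (λ b<a → ℕ.<⇒≱ (Lex⇒pos< (inj₁ b<a)) a≤b)

      finest-refines-Φ : Refines finest Φ
      finest-refines-Φ = ⊑⇒refines {Ψ = finest} {Φ} finest⊑Φ

      inBlock⇒ascent : ∀ {x y} → index Φ x ≡ index Φ y → ∀ c → pos x ≤ pos c → pos c < pos y → Ascent c
      inBlock⇒ascent {x} {y} x~y c x≤c c<y = c′ , c′≡c+1 , c≺c′ (pos<⇒Lex (subst (pos c <_) (sym c′≡c+1) (ℕ.n<1+n (pos c))))
        where
        c+1<n : suc (pos c) < n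
        c+1<n = ℕ.≤-<-trans c<y (Fin.toℕ<n (π y))
        c′ : Fin n
        c′ = proj₁ (π-surjective (fromℕ< c+1<n))
        c′≡c+1 : pos c′ ≡ suc (pos c)
        c′≡c+1 = trans (cong toℕ (proj₂ (π-surjective _))) (Fin.toℕ-fromℕ< c+1<n)
        inBlock : ∀ z → pos x ≤ pos z → pos z ≤ pos y → index Φ z ≡ index Φ x
        inBlock z x≤z z≤y = ℕ.≤-antisym (subst (index Φ z ≤_) (sym x~y) (finest⊑Φ z y z≤y)) (finest⊑Φ x z x≤z)
        c′≤y : pos c′ ≤ pos y
        c′≤y = subst (_≤ pos y) (sym c′≡c+1) c<y
        x≤c′ : pos x ≤ pos c′
        x≤c′ = ℕ.≤-trans x≤c (subst (pos c ≤_) (sym c′≡c+1) (ℕ.n≤1+n (pos c)))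
        c≺c′ : Lex (index Φ) _≺_ c c′ → c ≺ c′
        c≺c′ (inj₁ lt) = contradiction lt (ℕ.<-irrefl (trans (inBlock c x≤c (ℕ.<⇒≤ c<y)) (sym (inBlock c′ x≤c′ c′≤y))))
        c≺c′ (inj₂ (_ , c≺c′)) = c≺c′

      Φ-refines-coarsest : Refines Φ coarsest
      Φ-refines-coarsest = ⊑⇒refines {Ψ = Φ} {coarsest} (λ a b → coarsest-≤ ∘ runs)
        where
        runs : ∀ {a b} → index Φ a ≤ index Φ b → run a ≤ run b
        runs {a} {b} a≤b with index Φ a ℕ.<? index Φ b | pos a ℕ.≤? pos b
        ... | yes lt | _ = run-mono (ℕ.<⇒≤ (Lex⇒pos< (inj₁ lt)))
        ... | no ≮ | yes pa≤pb = ℕ.≤-reflexive (ascents⇒sameRun pa≤pb (inBlock⇒ascent (ℕ.≤-antisym a≤b (ℕ.≮⇒≥ ≮))))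
        ... | no ≮ | no pa≰pb =
          ℕ.≤-reflexive (sym (ascents⇒sameRun (ℕ.<⇒≤ (ℕ.≰⇒> pa≰pb)) (inBlock⇒ascent (ℕ.≤-antisym (ℕ.≮⇒≥ ≮) a≤b))))

  IsLinearExtension : Vec (Fin n) n → Set
  IsLinearExtension v = Sorted (labels v) × Satisfies C (labels v)

  isLinearExtension? : ∀ v → Dec (IsLinearExtension v)
  isLinearExtension? v = sorted? (labels v) ×-dec satisfies? C (labels v)

  linearExtensions : List (Vec (Fin n) n)
  linearExtensions = filter isLinearExtension? (allVecs n n)

  linearExtension : Fin (length linearExtensions) → Vec (Fin n) n
  linearExtension = List.lookup linearExtensions

  linearExtension-valid : ∀ i → IsLinearExtension (linearExtension i)
  linearExtension-valid i = proj₂ (∈-filter⁻ isLinearExtension? {xs = allVecs n n} (∈-lookup i))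

  module IntervalOf (i : Fin (length linearExtensions)) =
    Interval (Vec.lookup (linearExtension i)) (proj₁ (linearExtension-valid i)) (proj₂ (linearExtension-valid i))

  interval : Fin (length linearExtensions) → OSP n × OSP n
  interval i = IntervalOf.coarsest i , IntervalOf.finest i

  inInterval⇒sortedBy : ∀ i {Φ} → InInterval (interval i) Φ → labels (linearExtension i) ≗ sortRank (index Φ)
  inInterval⇒sortedBy i {Φ} (fin-ref , ref-coarse) = IntervalOf.InInterval.interval-sorted i {Φ} fin-ref ref-coarse

  inInterval⇒inK : ∀ i Φ → InInterval (interval i) Φ → InK C Φ
  inInterval⇒inK i Φ (fin-ref , ref-coarse) = satisfies⇒inK Φ (IntervalOf.InInterval.interval-sat i {Φ} fin-ref ref-coarse)

  intervals-disjoint : ∀ Φ i j → InInterval (interval i) Φ → InInterval (interval j) Φ → i ≡ j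
  intervals-disjoint Φ i j Φ∈i Φ∈j = Unique-lookup-injective (Unique.filter⁺ isLinearExtension? (allVecs-unique n n))
    (lookup-≗⇒≡ (λ a → Fin.toℕ-injective (trans (inInterval⇒sortedBy i {Φ} Φ∈i a) (sym (inInterval⇒sortedBy j {Φ} Φ∈j a)))))

  intervals-cover : ∀ Φ → InK C Φ → ∃ λ i → InInterval (interval i) Φ
  intervals-cover Φ inK =
    i , IntervalOf.SortedBy.finest-refines-Φ i {Φ} sortedBy , IntervalOf.SortedBy.Φ-refines-coarsest i {Φ} sortedBy
    where
    v₀ : Vec (Fin n) n
    v₀ = Vec.tabulate (sort (index Φ))
    labels-v₀ : labels v₀ ≗ sortRank (index Φ)
    labels-v₀ a = trans (cong toℕ (Vec.lookup∘tabulate (sort (index Φ)) a)) (toℕ-sort (index Φ) a)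
    v₀-isLinearExtension : IsLinearExtension v₀
    v₀-isLinearExtension = Sorted-resp-≗ {sortRank (index Φ)} (sym ∘ labels-v₀) (sortRank-sorted (index Φ))
                , Satisfies-resp-≗ {h = sortRank (index Φ)} (sym ∘ labels-v₀) (sortRank-sat (index Φ) (inK⇒satisfies Φ inK))
    v₀∈linearExtensions : v₀ ∈ linearExtensions
    v₀∈linearExtensions = ∈-filter⁺ isLinearExtension? (allVecs-complete v₀) v₀-isLinearExtension
    i : Fin (length linearExtensions)
    i = Any.index v₀∈linearExtensions
    sortedBy : labels (linearExtension i) ≗ sortRank (index Φ)
    sortedBy a = trans (cong (λ v → toℕ (Vec.lookup v a)) (sym (Any.lookup-index v₀∈linearExtensions))) (labels-v₀ a)

  partitionable : Partitionable n C
  partitionable = length linearExtensions , interval , (λ _ → refl) , IntervalOf.finest-refines-coarsest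
                , inInterval⇒inK , intervals-cover , intervals-disjoint

sumℚ-cong : ∀ {k} {f g : Fin k → ℚ} → f ≗ g → sumℚ f ≡ sumℚ g
sumℚ-cong {zero} _ = refl
sumℚ-cong {suc k} f≗g = cong₂ ℚ._+_ (f≗g Fin.zero) (sumℚ-cong (f≗g ∘ Fin.suc))

sumℚ-zero : ∀ {k} {f : Fin k → ℚ} → (∀ i → f i ≡ 0ℚ) → sumℚ f ≡ 0ℚ
sumℚ-zero {zero} _ = refl
sumℚ-zero {suc k} f≡0 = trans (cong₂ ℚ._+_ (f≡0 Fin.zero) (sumℚ-zero (f≡0 ∘ Fin.suc))) (ℚ.+-identityˡ 0ℚ)

sumℚ-linear : ∀ {k} (α β : ℚ) (f g : Fin k → ℚ) →
  sumℚ (λ i → α ℚ.* f i ℚ.+ β ℚ.* g i) ≡ α ℚ.* sumℚ f ℚ.+ β ℚ.* sumℚ g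
sumℚ-linear {zero} α β f g = solve 2 (λ α β → con 0ℚ := α :* con 0ℚ :+ β :* con 0ℚ) refl α β
sumℚ-linear {suc k} α β f g =
  trans (cong ((α ℚ.* f Fin.zero ℚ.+ β ℚ.* g Fin.zero) ℚ.+_) (sumℚ-linear α β (f ∘ Fin.suc) (g ∘ Fin.suc)))
        (solve 6 (λ α β f₀ g₀ F G → (α :* f₀ :+ β :* g₀) :+ (α :* F :+ β :* G) := α :* (f₀ :+ F) :+ β :* (g₀ :+ G)) refl
               α β (f Fin.zero) (g Fin.zero) (sumℚ (f ∘ Fin.suc)) (sumℚ (g ∘ Fin.suc)))

sumℚ-punchIn : ∀ {k} (i₀ : Fin (suc k)) (f : Fin (suc k) → ℚ) → sumℚ f ≡ f i₀ ℚ.+ sumℚ (f ∘ punchIn i₀)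
sumℚ-punchIn Fin.zero f = refl
sumℚ-punchIn {suc k} (Fin.suc i₀) f =
  trans (cong (f Fin.zero ℚ.+_) (sumℚ-punchIn i₀ (f ∘ Fin.suc)))
        (solve 3 (λ a b c → a :+ (b :+ c) := b :+ (a :+ c)) refl (f Fin.zero) (f (Fin.suc i₀)) (sumℚ (f ∘ Fin.suc ∘ punchIn i₀)))

sumℚ-single : ∀ {k} (i₀ : Fin k) (f : Fin k → ℚ) → (∀ j → j ≢ i₀ → f j ≡ 0ℚ) → sumℚ f ≡ f i₀
sumℚ-single {suc k} i₀ f others≡0 = begin
  sumℚ f                              ≡⟨ sumℚ-punchIn i₀ f ⟩
  f i₀ ℚ.+ sumℚ (f ∘ punchIn i₀)      ≡⟨ cong (f i₀ ℚ.+_) (sumℚ-zero (λ j → others≡0 (punchIn i₀ j) (Fin.punchInᵢ≢i i₀ j))) ⟩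
  f i₀ ℚ.+ 0ℚ                         ≡⟨ ℚ.+-identityʳ (f i₀) ⟩
  f i₀                                ∎
  where open ≡-Reasoning

NontrivialSolution : ∀ {m k} → (Fin m → Fin k → ℚ) → Set
NontrivialSolution {m} {k} A =
  Σ (Fin k → ℚ) λ μ → (∃ λ i → μ i ≢ 0ℚ) × (∀ r → sumℚ (λ i → μ i ℚ.* A r i) ≡ 0ℚ)

module Eliminate {m k} (A : Fin (suc m) → Fin (suc k) → ℚ) (i₀ : Fin (suc k)) (pivot≢0 : A Fin.zero i₀ ≢ 0ℚ) where
  private instance
    pivot-nonZero : ℚ.NonZero (A Fin.zero i₀)
    pivot-nonZero = ℚ.≢-nonZero pivot≢0

  w : ℚ
  w = ℚ.1/ A Fin.zero i₀

  reduced : Fin m → Fin k → ℚ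
  reduced r j = A (Fin.suc r) (punchIn i₀ j) ℚ.- A (Fin.suc r) i₀ ℚ.* (w ℚ.* A Fin.zero (punchIn i₀ j))

  lift : NontrivialSolution reduced → NontrivialSolution A
  lift (μ′ , (j₀ , μ′j₀≢0) , reduced-rows) = μ , (punchIn i₀ j₀ , μ′j₀≢0 ∘ trans (sym (μ-punchIn j₀))) , rows
    where
    S : ℚ
    S = sumℚ (λ j → μ′ j ℚ.* A Fin.zero (punchIn i₀ j))
    μ : Fin (suc k) → ℚ
    μ i with i₀ Fin.≟ i
    ... | yes _ = ℚ.- (w ℚ.* S)
    ... | no i₀≢i = μ′ (punchOut i₀≢i)
    μ-i₀ : μ i₀ ≡ ℚ.- (w ℚ.* S)
    μ-i₀ with i₀ Fin.≟ i₀
    ... | yes _ = refl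
    ... | no i₀≢i₀ = contradiction refl i₀≢i₀
    μ-punchIn : ∀ j → μ (punchIn i₀ j) ≡ μ′ j
    μ-punchIn j with i₀ Fin.≟ punchIn i₀ j
    ... | yes i₀≡ = contradiction (sym i₀≡) (Fin.punchInᵢ≢i i₀ j)
    ... | no _ = cong μ′ (trans (Fin.punchOut-cong i₀ refl) (Fin.punchOut-punchIn i₀))
    row-split : ∀ r → sumℚ (λ i → μ i ℚ.* A r i) ≡ ℚ.- (w ℚ.* S) ℚ.* A r i₀ ℚ.+ sumℚ (λ j → μ′ j ℚ.* A r (punchIn i₀ j))
    row-split r = trans (sumℚ-punchIn i₀ (λ i → μ i ℚ.* A r i))
                        (cong₂ ℚ._+_ (cong (ℚ._* A r i₀) μ-i₀) (sumℚ-cong (λ j → cong (ℚ._* A r (punchIn i₀ j)) (μ-punchIn j))))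
    rows : ∀ r → sumℚ (λ i → μ i ℚ.* A r i) ≡ 0ℚ
    rows Fin.zero = begin
      sumℚ (λ i → μ i ℚ.* A Fin.zero i)        ≡⟨ row-split Fin.zero ⟩
      ℚ.- (w ℚ.* S) ℚ.* a₀ ℚ.+ S               ≡⟨ factor w S a₀ ⟩
      S ℚ.* (1ℚ ℚ.- w ℚ.* a₀)                  ≡⟨ cong (λ x → S ℚ.* (1ℚ ℚ.- x)) (ℚ.*-inverseˡ a₀) ⟩
      S ℚ.* (1ℚ ℚ.- 1ℚ)                        ≡⟨ solve 1 (λ S → S :* (con 1ℚ :- con 1ℚ) := con 0ℚ) refl S ⟩
      0ℚ                                       ∎
      where
      open ≡-Reasoning
      a₀ = A Fin.zero i₀
      factor : ∀ w S a → ℚ.- (w ℚ.* S) ℚ.* a ℚ.+ S ≡ S ℚ.* (1ℚ ℚ.- w ℚ.* a)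
      factor = solve 3 (λ w S a → (:- (w :* S)) :* a :+ S := S :* (con 1ℚ :- w :* a)) refl
    rows (Fin.suc r) = begin
      sumℚ (λ i → μ i ℚ.* A (Fin.suc r) i)      ≡⟨ row-split (Fin.suc r) ⟩
      ℚ.- (w ℚ.* S) ℚ.* a ℚ.+ T                 ≡⟨ cong (ℚ.- (w ℚ.* S) ℚ.* a ℚ.+_) T≡awS ⟩
      ℚ.- (w ℚ.* S) ℚ.* a ℚ.+ a ℚ.* (w ℚ.* S)   ≡⟨ solve 3 (λ w S a → (:- (w :* S)) :* a :+ a :* (w :* S) := con 0ℚ) refl w S a ⟩
      0ℚ                                        ∎
      where
      open ≡-Reasoning
      a = A (Fin.suc r) i₀
      T = sumℚ (λ j → μ′ j ℚ.* A (Fin.suc r) (punchIn i₀ j))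
      expand : ∀ m x a w y → m ℚ.* (x ℚ.- a ℚ.* (w ℚ.* y)) ≡ 1ℚ ℚ.* (m ℚ.* x) ℚ.+ (ℚ.- (a ℚ.* w)) ℚ.* (m ℚ.* y)
      expand = solve 5 (λ m x a w y → m :* (x :- a :* (w :* y)) := con 1ℚ :* (m :* x) :+ (:- (a :* w)) :* (m :* y)) refl
      reduced-row : sumℚ (λ j → μ′ j ℚ.* reduced r j) ≡ 1ℚ ℚ.* T ℚ.+ (ℚ.- (a ℚ.* w)) ℚ.* S
      reduced-row = trans (sumℚ-cong (λ j → expand (μ′ j) (A (Fin.suc r) (punchIn i₀ j)) a w (A Fin.zero (punchIn i₀ j))))
                          (sumℚ-linear 1ℚ (ℚ.- (a ℚ.* w)) (λ j → μ′ j ℚ.* A (Fin.suc r) (punchIn i₀ j))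
                                                          (λ j → μ′ j ℚ.* A Fin.zero (punchIn i₀ j)))
      T≡awS : T ≡ a ℚ.* (w ℚ.* S)
      T≡awS = begin
        T                                                         ≡⟨ regroup T a w S ⟩
        (1ℚ ℚ.* T ℚ.+ (ℚ.- (a ℚ.* w)) ℚ.* S) ℚ.+ a ℚ.* (w ℚ.* S)  ≡⟨ cong (ℚ._+ a ℚ.* (w ℚ.* S)) reduced≡0 ⟩
        0ℚ ℚ.+ a ℚ.* (w ℚ.* S)                                    ≡⟨ ℚ.+-identityˡ _ ⟩
        a ℚ.* (w ℚ.* S)                                           ∎
        where
        reduced≡0 : 1ℚ ℚ.* T ℚ.+ (ℚ.- (a ℚ.* w)) ℚ.* S ≡ 0ℚ
        reduced≡0 = trans (sym reduced-row) (reduced-rows r)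
        regroup : ∀ T a w S → T ≡ (1ℚ ℚ.* T ℚ.+ (ℚ.- (a ℚ.* w)) ℚ.* S) ℚ.+ a ℚ.* (w ℚ.* S)
        regroup = solve 4 (λ T a w S → T := (con 1ℚ :* T :+ (:- (a :* w)) :* S) :+ a :* (w :* S)) refl

nontrivialSolution : ∀ m k → m < k → (A : Fin m → Fin k → ℚ) → NontrivialSolution A
nontrivialSolution zero (suc k) _ A = μ , (Fin.zero , ℚ.<⇒≢ (ℚ.positive⁻¹ 1ℚ) ∘ sym) , λ ()
  where
  μ : Fin (suc k) → ℚ
  μ Fin.zero = 1ℚ
  μ (Fin.suc _) = 0ℚ
nontrivialSolution (suc m) (suc k) (s≤s m<k) A with Fin.any? (λ i → ¬? (A Fin.zero i ℚ.≟ 0ℚ))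
... | yes (i₀ , pivot≢0) = Eliminate.lift A i₀ pivot≢0 (nontrivialSolution m k m<k (Eliminate.reduced A i₀ pivot≢0))
... | no noPivot with nontrivialSolution m (suc k) (ℕ.m<n⇒m<1+n m<k) (A ∘ Fin.suc)
...   | μ , nontrivial , rows = μ , nontrivial , λ { Fin.zero → row₀ ; (Fin.suc r) → rows r }
  where
  row₀ : sumℚ (λ i → μ i ℚ.* A Fin.zero i) ≡ 0ℚ
  row₀ = sumℚ-zero λ i → trans (cong (μ i ℚ.*_) (decidable-stable (A Fin.zero i ℚ.≟ 0ℚ) (λ ≢0 → noPivot (i , ≢0))))
                                (ℚ.*-zeroʳ (μ i))

hasIndep⇒≤ : ∀ {n d} {S : PSet n} → HasIndep S (suc d) → d ≤ n
hasIndep⇒≤ {n} {d} (p , _ , independent) with d ℕ.≤? n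
... | yes d≤n = d≤n
... | no d≰n = contradiction (independent μ Σμ≡0 (rows ∘ Fin.suc) i) μi≢0
  where
  A : Fin (suc n) → Fin (suc d) → ℚ
  A Fin.zero _ = 1ℚ
  A (Fin.suc j) i = p i j
  solution = nontrivialSolution (suc n) (suc d) (s≤s (ℕ.≰⇒> d≰n)) A
  μ = proj₁ solution
  i = proj₁ (proj₁ (proj₂ solution))
  μi≢0 = proj₂ (proj₁ (proj₂ solution))
  rows = proj₂ (proj₂ solution)
  Σμ≡0 : sumℚ μ ≡ 0ℚ
  Σμ≡0 = trans (sumℚ-cong (λ i → sym (ℚ.*-identityʳ (μ i)))) (rows Fin.zero)

indicator : ℕ → ℕ → ℕ
indicator x y with x ℕ.≟ y
... | yes _ = 1
... | no _ = 0

indicator≤1 : ∀ x y → indicator x y ≤ 1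
indicator≤1 x y with x ℕ.≟ y
... | yes _ = s≤s z≤n
... | no _ = z≤n

indicator-< : ∀ {x y} → x ≢ y → indicator x y < indicator y y
indicator-< {x} {y} x≢y with x ℕ.≟ y | y ℕ.≟ y
... | yes x≡y | _ = contradiction x≡y x≢y
... | no _ | yes _ = s≤s z≤n
... | no _ | no y≢y = contradiction refl y≢y

double-mono-< : ∀ {x y} → x < y → suc (x + x) < y + y
double-mono-< {x} {y} x<y = subst (_≤ y + y) (cong suc (ℕ.+-suc x x)) (ℕ.+-mono-≤ x<y x<y)

module FullDimensional {n} (C : Conj n) (π : Fin n → Fin n)
  (π-surjective : ∀ k → ∃ λ a → π a ≡ k) (π-sat : Satisfies C (toℕ ∘ π)) where

  pos : Labeling n
  pos = toℕ ∘ π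

  vertexLabel : ℕ → Labeling n
  vertexLabel i j = (pos j + pos j) + indicator (pos j) i

  vertex : ℕ → Point n
  vertex i = realise (n + n) (vertexLabel i)

  vertexLabel-≤ : ∀ i j → vertexLabel i j ≤ suc (pos j + pos j)
  vertexLabel-≤ i j = subst (vertexLabel i j ≤_) (ℕ.+-comm (pos j + pos j) 1) (ℕ.+-monoʳ-≤ (pos j + pos j) (indicator≤1 (pos j) i))

  vertexLabel-mono-< : ∀ i {a b} → pos a < pos b → vertexLabel i a < vertexLabel i b
  vertexLabel-mono-< i {a} {b} a<b =
    ℕ.≤-<-trans (vertexLabel-≤ i a) (ℕ.<-≤-trans (double-mono-< a<b) (ℕ.m≤m+n (pos b + pos b) (indicator (pos b) i)))

  vertex-sol : ∀ i → Sol C (vertex i)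
  vertex-sol i = realise-sol (n + n) (vertexLabel i) bounded (mapIneq weakly (vertexLabel-mono-< i) π-sat)
    where
    bounded : ∀ j → vertexLabel i j ≤ n + n
    bounded j = ℕ.≤-trans (vertexLabel-≤ i j) (ℕ.<⇒≤ (double-mono-< (Fin.toℕ<n (π j))))
    weakly : ∀ {a b} → pos a ≤ pos b → vertexLabel i a ≤ vertexLabel i b
    weakly a≤b with ℕ.m≤n⇒m<n∨m≡n a≤b
    ... | inj₁ a<b = ℕ.<⇒≤ (vertexLabel-mono-< i a<b)
    ... | inj₂ a≡b = ℕ.≤-reflexive (cong (λ p → (p + p) + indicator p i) a≡b)

  bump : ℕ → Fin n → ℚ
  bump i j = ofℕ (indicator (pos j) i)

  vertex-split : ∀ i j → vertex i j ≡ ofℕ (suc (pos j + pos j)) ℚ.* scale (n + n) ℚ.+ bump i j ℚ.* scale (n + n)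
  vertex-split i j = trans (cong (ℚ._* scale (n + n)) (ofℕ-+ (suc (pos j + pos j)) (indicator (pos j) i)))
                           (ℚ.*-distribʳ-+ (scale (n + n)) (ofℕ (suc (pos j + pos j))) (bump i j))

  bump-at : ∀ {i j} → pos j ≡ i → bump i j ≡ 1ℚ
  bump-at {i} {j} pj≡i with pos j ℕ.≟ i
  ... | yes _ = ℚ.+-identityʳ 1ℚ
  ... | no pj≢i = contradiction pj≡i pj≢i

  bump-off : ∀ {i j} → pos j ≢ i → bump i j ≡ 0ℚ
  bump-off {i} {j} pj≢i with pos j ℕ.≟ i
  ... | yes pj≡i = contradiction pj≡i pj≢i
  ... | no _ = refl

  vertices-independent : ∀ m → m ≤ suc n → AffinelyIndependent {n} {m} (vertex ∘ toℕ)
  vertices-independent m m≤1+n λc Σλ≡0 Σλv≡0 = λc≡0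
    where
    r : ℚ
    r = scale (n + n)
    D : Fin n → ℚ
    D j = sumℚ (λ i → λc i ℚ.* bump (toℕ i) j)
    r*D≡0 : ∀ j → r ℚ.* D j ≡ 0ℚ
    r*D≡0 j = begin
      r ℚ.* D j                                                    ≡⟨ solve 2 (λ B rD → rD := B :* con 0ℚ :+ rD) refl B (r ℚ.* D j) ⟩
      B ℚ.* 0ℚ ℚ.+ r ℚ.* D j                                       ≡⟨ cong (λ z → B ℚ.* z ℚ.+ r ℚ.* D j) (sym Σλ≡0) ⟩
      B ℚ.* sumℚ λc ℚ.+ r ℚ.* D j                                  ≡⟨ sumℚ-linear B r λc (λ i → λc i ℚ.* bump (toℕ i) j) ⟨
      sumℚ (λ i → B ℚ.* λc i ℚ.+ r ℚ.* (λc i ℚ.* bump (toℕ i) j))  ≡⟨ sumℚ-cong regroup ⟩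
      sumℚ (λ i → λc i ℚ.* vertex (toℕ i) j)                       ≡⟨ Σλv≡0 j ⟩
      0ℚ                                                           ∎
      where
      open ≡-Reasoning
      B = ofℕ (suc (pos j + pos j)) ℚ.* r
      regroup : ∀ i → B ℚ.* λc i ℚ.+ r ℚ.* (λc i ℚ.* bump (toℕ i) j) ≡ λc i ℚ.* vertex (toℕ i) j
      regroup i = trans (solve 4 (λ B r l d → B :* l :+ r :* (l :* d) := l :* (B :+ d :* r)) refl B r (λc i) (bump (toℕ i) j))
                        (cong (λc i ℚ.*_) (sym (vertex-split (toℕ i) j)))
    λc-below : ∀ i → toℕ i < n → λc i ≡ 0ℚ
    λc-below i i<n = begin
      λc i                      ≡⟨ ℚ.*-identityʳ (λc i) ⟨
      λc i ℚ.* 1ℚ               ≡⟨ cong (λc i ℚ.*_) (bump-at pj≡i) ⟨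
      λc i ℚ.* bump (toℕ i) j   ≡⟨ sumℚ-single i (λ i′ → λc i′ ℚ.* bump (toℕ i′) j) others≡0 ⟨
      D j                       ≡⟨ ℚ-*-cancelˡ-≡0 r {{scale-positive (n + n)}} (r*D≡0 j) ⟩
      0ℚ                        ∎
      where
      open ≡-Reasoning
      j = proj₁ (π-surjective (fromℕ< i<n))
      pj≡i : pos j ≡ toℕ i
      pj≡i = trans (cong toℕ (proj₂ (π-surjective (fromℕ< i<n)))) (Fin.toℕ-fromℕ< i<n)
      others≡0 : ∀ i′ → i′ ≢ i → λc i′ ℚ.* bump (toℕ i′) j ≡ 0ℚ
      others≡0 i′ i′≢i = trans (cong (λc i′ ℚ.*_) (bump-off (λ pj≡i′ → i′≢i (Fin.toℕ-injective (trans (sym pj≡i′) pj≡i)))))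
                               (ℚ.*-zeroʳ (λc i′))
    λc≡0 : ∀ i → λc i ≡ 0ℚ
    λc≡0 i with toℕ i ℕ.<? n
    ... | yes i<n = λc-below i i<n
    ... | no i≮n = trans (sym (sumℚ-single i λc (λ j j≢i → λc-below j (j<n j j≢i)))) Σλ≡0
      where
      i≡n : toℕ i ≡ n
      i≡n = ℕ.≤-antisym (ℕ.≤-pred (ℕ.<-≤-trans (Fin.toℕ<n i) m≤1+n)) (ℕ.≮⇒≥ i≮n)
      j<n : ∀ j → j ≢ i → toℕ j < n
      j<n j j≢i = ℕ.≤∧≢⇒< (ℕ.≤-pred (ℕ.<-≤-trans (Fin.toℕ<n j) m≤1+n)) (λ j≡n → j≢i (Fin.toℕ-injective (trans j≡n (sym i≡n))))

  hasIndep : ∀ m → m ≤ suc n → HasIndep (Sol C) m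
  hasIndep m m≤1+n = vertex ∘ toℕ , vertex-sol ∘ toℕ , vertices-independent m m≤1+n

dim≡n : ∀ {n d} (C : Conj n) → HasDim (Sol C) d → (π : Fin n → Fin n) →
  (∀ k → ∃ λ a → π a ≡ k) → Satisfies C (toℕ ∘ π) → d ≡ n
dim≡n {n} {d} C (hasIndep , ¬hasIndep) π π-surjective π-sat = ℕ.≤-antisym (hasIndep⇒≤ {S = Sol C} hasIndep) n≤d
  where
  n≤d : n ≤ d
  n≤d = ℕ.≮⇒≥ (λ d<n → ¬hasIndep (FullDimensional.hasIndep C π π-surjective π-sat (suc (suc d)) (s≤s d<n)))

dot-linear : ∀ {n} (c x z : Point n) (α β : ℚ) →
  dot c (λ i → α ℚ.* x i ℚ.+ β ℚ.* z i) ≡ α ℚ.* dot c x ℚ.+ β ℚ.* dot c z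
dot-linear c x z α β = trans
  (sumℚ-cong (λ i → solve 5 (λ c x z α β → c :* (α :* x :+ β :* z) := α :* (c :* x) :+ β :* (c :* z)) refl (c i) (x i) (z i) α β))
  (sumℚ-linear α β (λ i → c i ℚ.* x i) (λ i → c i ℚ.* z i))

move : ∀ {n} → Point n → ℚ → Point n → Point n
move y t v i = y i ℚ.+ t ℚ.* v i

dot-move : ∀ {n} (c y : Point n) t v → dot c (move y t v) ≡ dot c y ℚ.+ t ℚ.* dot c v
dot-move c y t v = begin
  dot c (move y t v)                         ≡⟨ sumℚ-cong (λ i → cong (λ u → c i ℚ.* (u ℚ.+ t ℚ.* v i)) (sym (ℚ.*-identityˡ (y i)))) ⟩
  dot c (λ i → 1ℚ ℚ.* y i ℚ.+ t ℚ.* v i)     ≡⟨ dot-linear c y v 1ℚ t ⟩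
  1ℚ ℚ.* dot c y ℚ.+ t ℚ.* dot c v           ≡⟨ cong (ℚ._+ t ℚ.* dot c v) (ℚ.*-identityˡ (dot c y)) ⟩
  dot c y ℚ.+ t ℚ.* dot c v                  ∎
  where open ≡-Reasoning

strict-slack : ∀ A D β → A ℚ.< β → ∃ λ t → 0ℚ ℚ.< t × (∀ t′ → 0ℚ ℚ.≤ t′ → t′ ℚ.≤ t → A ℚ.+ t′ ℚ.* D ℚ.< β)
strict-slack A D β A<β with D ℚ.≤? 0ℚ
... | yes D≤0 = 1ℚ , ℚ.positive⁻¹ 1ℚ , λ t′ t′≥0 _ →
  ℚ.≤-<-trans (subst (A ℚ.+ t′ ℚ.* D ℚ.≤_) (ℚ.+-identityʳ A)
                     (ℚ.+-monoʳ-≤ A (subst (t′ ℚ.* D ℚ.≤_) (ℚ.*-zeroʳ t′) (ℚ.*-monoˡ-≤-nonNeg t′ {{ℚ.nonNegative t′≥0}} D≤0))))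
              A<β
... | no D≰0 = t , ℚ.positive⁻¹ t , below
  where
  s : ℚ
  s = β ℚ.- A
  instance
    D>0 : ℚ.Positive D
    D>0 = ℚ.positive (ℚ.≰⇒> D≰0)
    D≢0 : ℚ.NonZero D
    D≢0 = ℚ.pos⇒nonZero D
    s>0 : ℚ.Positive s
    s>0 = ℚ.positive (subst (ℚ._< s) (ℚ.+-inverseʳ A) (ℚ.+-monoˡ-< (ℚ.- A) A<β))
    ½>0 : ℚ.Positive ℚ.½
    ½>0 = _
    1/D>0 : ℚ.Positive (ℚ.1/ D)
    1/D>0 = ℚ.1/pos⇒pos D
    s/D>0 : ℚ.Positive (s ℚ.* ℚ.1/ D)
    s/D>0 = ℚ.pos*pos⇒pos s (ℚ.1/ D)
    t>0 : ℚ.Positive (s ℚ.* ℚ.1/ D ℚ.* ℚ.½)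
    t>0 = ℚ.pos*pos⇒pos (s ℚ.* ℚ.1/ D) ℚ.½
  t : ℚ
  t = s ℚ.* ℚ.1/ D ℚ.* ℚ.½
  t*D≡s/2 : t ℚ.* D ≡ s ℚ.* ℚ.½
  t*D≡s/2 = begin
    t ℚ.* D                                 ≡⟨ solve 4 (λ s w h D → s :* w :* h :* D := (s :* h) :* (w :* D)) refl s (ℚ.1/ D) ℚ.½ D ⟩
    (s ℚ.* ℚ.½) ℚ.* (ℚ.1/ D ℚ.* D)          ≡⟨ cong ((s ℚ.* ℚ.½) ℚ.*_) (ℚ.*-inverseˡ D) ⟩
    (s ℚ.* ℚ.½) ℚ.* 1ℚ                      ≡⟨ ℚ.*-identityʳ (s ℚ.* ℚ.½) ⟩
    s ℚ.* ℚ.½                               ∎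
    where open ≡-Reasoning
  t*D<s : t ℚ.* D ℚ.< s
  t*D<s = subst₂ ℚ._<_ (sym t*D≡s/2) (ℚ.*-identityʳ s) (ℚ.*-monoʳ-<-pos s (from-yes (ℚ.½ ℚ.<? 1ℚ)))
  below : ∀ t′ → 0ℚ ℚ.≤ t′ → t′ ℚ.≤ t → A ℚ.+ t′ ℚ.* D ℚ.< β
  below t′ _ t′≤t = ℚ.≤-<-trans (ℚ.+-monoʳ-≤ A (ℚ.*-monoʳ-≤-nonNeg D {{ℚ.pos⇒nonNeg D}} t′≤t))
                               (subst (A ℚ.+ t ℚ.* D ℚ.<_) (solve 2 (λ A β → A :+ (β :- A) := β) refl A β) (ℚ.+-monoʳ-< A t*D<s))

Descends : ∀ {n} → Point n → LinIneq n → Set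
Descends v (lineq c _ weak) = dot c v ℚ.≤ 0ℚ
Descends v (lineq _ _ strict) = ⊤

HoldsAlong : ∀ {n} → Point n → Point n → ℚ → LinIneq n → Set
HoldsAlong y v t l = ∀ t′ → 0ℚ ℚ.≤ t′ → t′ ℚ.≤ t → holdsLin l (move y t′ v)

holdsAlong : ∀ {n} (l : LinIneq n) {y v} → holdsLin l y → Descends v l → ∃ λ t → 0ℚ ℚ.< t × HoldsAlong y v t l
holdsAlong (lineq c β strict) {y} {v} c·y<β _ with strict-slack (dot c y) (dot c v) β c·y<β
... | t , t>0 , below = t , t>0 , λ t′ t′≥0 t′≤t → subst (ℚ._< β) (sym (dot-move c y t′ v)) (below t′ t′≥0 t′≤t)
holdsAlong (lineq c β weak) {y} {v} c·y≤β c·v≤0 = 1ℚ , ℚ.positive⁻¹ 1ℚ , λ t′ t′≥0 _ →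
  subst (ℚ._≤ β) (sym (dot-move c y t′ v))
        (ℚ.≤-trans (subst (dot c y ℚ.+ t′ ℚ.* dot c v ℚ.≤_) (ℚ.+-identityʳ (dot c y))
                          (ℚ.+-monoʳ-≤ (dot c y) (subst (t′ ℚ.* dot c v ℚ.≤_) (ℚ.*-zeroʳ t′)
                                                        (ℚ.*-monoˡ-≤-nonNeg t′ {{ℚ.nonNegative t′≥0}} c·v≤0))))
                   c·y≤β)

holdsAlong-all : ∀ {n} (L : List (LinIneq n)) {y v} → All (λ l → holdsLin l y) L → All (Descends v) L →
  ∃ λ t → 0ℚ ℚ.< t × All (HoldsAlong y v t) L
holdsAlong-all [] _ _ = 1ℚ , ℚ.positive⁻¹ 1ℚ , All.[]
holdsAlong-all (l ∷ L) (holds All.∷ holdsL) (descends All.∷ descendsL)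
  with holdsAlong l holds descends | holdsAlong-all L holdsL descendsL
... | t₁ , t₁>0 , along₁ | t₂ , t₂>0 , along₂ with t₁ ℚ.≤? t₂
...   | yes t₁≤t₂ = t₁ , t₁>0 , along₁ All.∷ All.map (λ along t′ t′≥0 t′≤t₁ → along t′ t′≥0 (ℚ.≤-trans t′≤t₁ t₁≤t₂)) along₂
...   | no t₁≰t₂ = t₂ , t₂>0 , (λ t′ t′≥0 t′≤t₂ → along₁ t′ t′≥0 (ℚ.≤-trans t′≤t₂ (ℚ.<⇒≤ (ℚ.≰⇒> t₁≰t₂)))) All.∷ along₂

move-inside : ∀ {n} (L : List (LinIneq n)) {y v} → All (λ l → holdsLin l y) L → All (Descends v) L →
  ∃ λ t → 0ℚ ℚ.< t × All (λ l → holdsLin l (move y t v)) L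
move-inside L holdsL descendsL with holdsAlong-all L holdsL descendsL
... | t , t>0 , along = t , t>0 , All.map (λ along-l → along-l t (ℚ.<⇒≤ t>0) ℚ.≤-refl) along

noWeak⇒descends : ∀ {n} (L : List (LinIneq n)) → numWeak L ≡ 0 → ∀ v → All (Descends v) L
noWeak⇒descends [] _ _ = All.[]
noWeak⇒descends (lineq _ _ strict ∷ L) none v = tt All.∷ noWeak⇒descends L none v

atMostOneWeak⇒halfSpace : ∀ {n} (L : List (LinIneq n)) → numWeak L ≤ 1 →
  ∃ λ c → ∀ v → dot c v ℚ.≤ 0ℚ → All (Descends v) L
atMostOneWeak⇒halfSpace [] _ = (λ _ → 0ℚ) , λ _ _ → All.[]
atMostOneWeak⇒halfSpace (lineq c _ weak ∷ L) (s≤s none) = c , λ v c·v≤0 → c·v≤0 All.∷ noWeak⇒descends L (ℕ.n≤0⇒n≡0 none) v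
atMostOneWeak⇒halfSpace (lineq _ _ strict ∷ L) weak≤1 with atMostOneWeak⇒halfSpace L weak≤1
... | c , descends = c , λ v c·v≤0 → tt All.∷ descends v c·v≤0

basis : ∀ {n} → Fin n → Point n
basis a i with a Fin.≟ i
... | yes _ = 1ℚ
... | no _ = 0ℚ

basis-self : ∀ {n} (a : Fin n) → basis a a ≡ 1ℚ
basis-self a with a Fin.≟ a
... | yes _ = refl
... | no a≢a = contradiction refl a≢a

basis-other : ∀ {n} {a i : Fin n} → a ≢ i → basis a i ≡ 0ℚ
basis-other {a = a} {i} a≢i with a Fin.≟ i
... | yes a≡i = contradiction a≡i a≢i
... | no _ = refl

basis-nonNeg : ∀ {n} (a i : Fin n) → 0ℚ ℚ.≤ basis a i
basis-nonNeg a i with a Fin.≟ i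
... | yes _ = ℚ.<⇒≤ (ℚ.positive⁻¹ 1ℚ)
... | no _ = ℚ.≤-refl

basis-≤1 : ∀ {n} (a i : Fin n) → basis a i ℚ.≤ 1ℚ
basis-≤1 a i with a Fin.≟ i
... | yes _ = ℚ.≤-refl
... | no _ = ℚ.<⇒≤ (ℚ.positive⁻¹ 1ℚ)

edge : ∀ {n} → Fin n → Fin n → Point n
edge a b i = basis a i ℚ.- basis b i

edge-head : ∀ {n} {a b : Fin n} → a ≢ b → edge a b a ≡ 1ℚ
edge-head {a = a} a≢b = cong₂ ℚ._-_ (basis-self a) (basis-other (a≢b ∘ sym))

edge-tail : ∀ {n} {a b : Fin n} → a ≢ b → edge a b b ≡ ℚ.- 1ℚ
edge-tail {b = b} a≢b = cong₂ ℚ._-_ (basis-other a≢b) (basis-self b)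

edge-rise≤1 : ∀ {n} {a b a′ b′ : Fin n} → a′ ≢ a ⊎ b′ ≢ b → edge a′ b′ a ℚ.- edge a′ b′ b ℚ.≤ 1ℚ
edge-rise≤1 {a = a} {b} {a′} {b′} distinct = ℚ.≤-trans rise≤e₁+e₄ (e₁+e₄≤1 distinct)
  where
  e₁ = basis a′ a
  e₂ = basis b′ a
  e₃ = basis a′ b
  e₄ = basis b′ b
  rise≤e₁+e₄ : (e₁ ℚ.- e₂) ℚ.- (e₃ ℚ.- e₄) ℚ.≤ e₁ ℚ.+ e₄
  rise≤e₁+e₄ = ℚ-≤-translate ((e₁ ℚ.- e₂) ℚ.- (e₃ ℚ.- e₄))
    (solve 5 (λ e₁ e₂ e₃ e₄ X → con 0ℚ :+ X := X) refl e₁ e₂ e₃ e₄ _)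
    (solve 4 (λ e₁ e₂ e₃ e₄ → (e₂ :+ e₃) :+ ((e₁ :- e₂) :- (e₃ :- e₄)) := e₁ :+ e₄) refl e₁ e₂ e₃ e₄)
    (ℚ.+-mono-≤ (basis-nonNeg b′ a) (basis-nonNeg a′ b))
  e₁+e₄≤1 : a′ ≢ a ⊎ b′ ≢ b → e₁ ℚ.+ e₄ ℚ.≤ 1ℚ
  e₁+e₄≤1 (inj₁ a′≢a) = subst (λ e → e ℚ.+ e₄ ℚ.≤ 1ℚ) (sym (basis-other a′≢a))
                              (subst (ℚ._≤ 1ℚ) (sym (ℚ.+-identityˡ e₄)) (basis-≤1 b′ b))
  e₁+e₄≤1 (inj₂ b′≢b) = subst (λ e → e₁ ℚ.+ e ℚ.≤ 1ℚ) (sym (basis-other b′≢b))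
                              (subst (ℚ._≤ 1ℚ) (sym (ℚ.+-identityʳ e₁)) (basis-≤1 a′ a))

doubling-cycle : ∀ {p q} → 0ℚ ℚ.< p → q ℚ.+ q ℚ.≤ p → p ℚ.+ p ℚ.≤ q → ⊥
doubling-cycle {p} {q} p>0 2q≤p 2p≤q = ℚ-≤⇒≯ (ℚ.≤-trans p≤2p (ℚ.≤-trans 2p≤q q≤0)) p>0
  where
  p≤2p : p ℚ.≤ p ℚ.+ p
  p≤2p = subst (ℚ._≤ p ℚ.+ p) (ℚ.+-identityʳ p) (ℚ.+-monoʳ-≤ p (ℚ.<⇒≤ p>0))
  q≤0 : q ℚ.≤ 0ℚ
  q≤0 = ℚ-≤-translate (ℚ.- q) (solve 1 (λ q → q :+ q :+ (:- q) := q) refl q) (solve 1 (λ q → q :+ (:- q) := con 0ℚ) refl q)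
                      (ℚ.≤-trans 2q≤p (ℚ.≤-trans p≤2p 2p≤q))

tie⇒rise≤0 : ∀ {n} {C : Conj n} {a b y v t} → bineq a b weak ∈ C → y a ≡ y b →
  0ℚ ℚ.< t → Sol C (move y t v) → v a ℚ.≤ v b
tie⇒rise≤0 {a = a} {b} {y} {v} {t} a≤b∈C ya≡yb t>0 (_ , sat) = ℚ.*-cancelˡ-≤-pos t {{ℚ.positive t>0}} t·va≤t·vb
  where
  moved : y b ℚ.+ t ℚ.* v a ℚ.≤ y b ℚ.+ t ℚ.* v b
  moved = subst (λ u → u ℚ.+ t ℚ.* v a ℚ.≤ y b ℚ.+ t ℚ.* v b) ya≡yb (All.lookup sat a≤b∈C)
  t·va≤t·vb : t ℚ.* v a ℚ.≤ t ℚ.* v b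
  t·va≤t·vb = ℚ-≤-translate (ℚ.- y b) (solve 2 (λ yb X → yb :+ X :+ (:- yb) := X) refl (y b) (t ℚ.* v a))
                                      (solve 2 (λ yb X → yb :+ X :+ (:- yb) := X) refl (y b) (t ℚ.* v b)) moved

module TightEdges {n} {C : Conj n} {L : List (LinIneq n)}
  (sol⇔L : ∀ x → Sol C x ⇔ All (λ l → holdsLin l x) L) (weak≤1 : numWeak L ≤ 1) where

  c : Point n
  c = proj₁ (atMostOneWeak⇒halfSpace L weak≤1)

  move-inside-sol : ∀ {y} v → Sol C y → dot c v ℚ.≤ 0ℚ → ∃ λ t → 0ℚ ℚ.< t × Sol C (move y t v)
  move-inside-sol {y} v sol c·v≤0
    with move-inside L (Equivalence.to (sol⇔L y) sol) (proj₂ (atMostOneWeak⇒halfSpace L weak≤1) v c·v≤0)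
  ... | t , t>0 , holds = t , t>0 , Equivalence.from (sol⇔L _) holds

  tightEdge⇒rise≤0 : ∀ {a b} → TightEdge C a b → ∀ v → dot c v ℚ.≤ 0ℚ → v a ℚ.≤ v b
  tightEdge⇒rise≤0 (a≤b∈C , _ , y , sol , ya≡yb) v c·v≤0 with move-inside-sol v sol c·v≤0
  ... | t , t>0 , moved = tie⇒rise≤0 a≤b∈C ya≡yb t>0 moved

  tightEdge-ascends : ∀ {a b} → TightEdge C a b → 0ℚ ℚ.< dot c (edge a b)
  tightEdge-ascends {a} {b} tight@(_ , a≢b , _) = ℚ.≰⇒> λ c·e≤0 →
    ℚ-≤⇒≯ (subst₂ ℚ._≤_ (edge-head a≢b) (edge-tail a≢b) (tightEdge⇒rise≤0 tight (edge a b) c·e≤0))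
          (ℚ.<-trans (ℚ.neg-antimono-< (ℚ.positive⁻¹ 1ℚ)) (ℚ.positive⁻¹ 1ℚ))

  tightEdge-dominates : ∀ {a b a′ b′} → TightEdge C a b → a′ ≢ a ⊎ b′ ≢ b →
    dot c (edge a′ b′) ℚ.+ dot c (edge a′ b′) ℚ.≤ dot c (edge a b)
  tightEdge-dominates {a} {b} {a′} {b′} tight@(_ , a≢b , _) distinct = ℚ.≤-trans 2Q≤P·rise P·rise≤P
    where
    P = dot c (edge a b)
    Q = dot c (edge a′ b′)
    v : Point n
    v i = Q ℚ.* edge a b i ℚ.+ (ℚ.- P) ℚ.* edge a′ b′ i
    c·v≡0 : dot c v ≡ 0ℚ
    c·v≡0 = trans (dot-linear c (edge a b) (edge a′ b′) Q (ℚ.- P)) (solve 2 (λ P Q → Q :* P :+ (:- P) :* Q := con 0ℚ) refl P Q)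
    x = edge a′ b′ a
    z = edge a′ b′ b
    va≤vb : Q ℚ.* 1ℚ ℚ.+ (ℚ.- P) ℚ.* x ℚ.≤ Q ℚ.* (ℚ.- 1ℚ) ℚ.+ (ℚ.- P) ℚ.* z
    va≤vb = subst₂ (λ h t → Q ℚ.* h ℚ.+ (ℚ.- P) ℚ.* x ℚ.≤ Q ℚ.* t ℚ.+ (ℚ.- P) ℚ.* z) (edge-head a≢b) (edge-tail a≢b)
                   (tightEdge⇒rise≤0 tight v (ℚ.≤-reflexive c·v≡0))
    2Q≤P·rise : Q ℚ.+ Q ℚ.≤ P ℚ.* (x ℚ.- z)
    2Q≤P·rise = ℚ-≤-translate (Q ℚ.+ P ℚ.* x)
      (solve 3 (λ P Q x → Q :* con 1ℚ :+ (:- P) :* x :+ (Q :+ P :* x) := Q :+ Q) refl P Q x)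
      (solve 4 (λ P Q x z → Q :* (:- con 1ℚ) :+ (:- P) :* z :+ (Q :+ P :* x) := P :* (x :- z)) refl P Q x z) va≤vb
    P·rise≤P : P ℚ.* (x ℚ.- z) ℚ.≤ P
    P·rise≤P = subst (P ℚ.* (x ℚ.- z) ℚ.≤_) (ℚ.*-identityʳ P)
                     (ℚ.*-monoˡ-≤-nonNeg P {{ℚ.nonNegative (ℚ.<⇒≤ (tightEdge-ascends tight))}} (edge-rise≤1 distinct))

  distinctTightEdges⇒⊥ : ∀ {a b a′ b′} → TightEdge C a b → TightEdge C a′ b′ → a ≢ a′ ⊎ b ≢ b′ → ⊥
  distinctTightEdges⇒⊥ tight tight′ distinct =
    doubling-cycle (tightEdge-ascends tight) (tightEdge-dominates tight (Sum.map (_∘ sym) (_∘ sym) distinct))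
                   (tightEdge-dominates tight′ distinct)

  tightEdge-unique : ∀ {a b a′ b′} → TightEdge C a b → TightEdge C a′ b′ → a ≡ a′ × b ≡ b′
  tightEdge-unique {a} {b} {a′} {b′} tight tight′ with a Fin.≟ a′ | b Fin.≟ b′
  ... | yes a≡a′ | yes b≡b′ = a≡a′ , b≡b′
  ... | no a≢a′ | _ = ⊥-elim (distinctTightEdges⇒⊥ tight tight′ (inj₁ a≢a′))
  ... | _ | no b≢b′ = ⊥-elim (distinctTightEdges⇒⊥ tight tight′ (inj₂ b≢b′))

record ShellingKeys {n} (C : Conj n) : Set where
  field
    primary secondary : Labeling n
    primary-sat : Satisfies C primary
    tight-oriented : ∀ {a b} → TightEdge C a b → primary a ≡ primary b × secondary b < secondary a

  _≺_ : Rel (Fin n) 0ℓ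
  a ≺ b = Lex primary (Lex secondary Fin._<_) b a

  ≺-isStrictTotalOrder : IsStrictTotalOrder _≡_ _≺_
  ≺-isStrictTotalOrder =
    Flip.isStrictTotalOrder (Lex-isStrictTotalOrder primary (Lex-isStrictTotalOrder secondary Fin.<-isStrictTotalOrder))

  strict⇒≻ : ∀ {a b} → bineq a b strict ∈ C → b ≺ a
  strict⇒≻ a<b∈C = inj₁ (All.lookup primary-sat a<b∈C)

  tight⇒≺ : ∀ {a b} → TightEdge C a b → a ≺ b
  tight⇒≺ tight = inj₂ (sym (proj₁ (tight-oriented tight)) , inj₁ (proj₂ (tight-oriented tight)))

TightIneq : ∀ {n} → Conj n → BasicIneq n → Set
TightIneq C (bineq a b weak) = a ≢ b × Tight C a b
TightIneq C (bineq a b strict) = ⊥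

tightIneq? : ∀ {n} (C : Conj n) ι → Dec (TightIneq C ι)
tightIneq? C (bineq a b weak) = ¬? (a Fin.≟ b) ×-dec tight? C a b
tightIneq? C (bineq a b strict) = no id

shellingKeys : ∀ {n} {C : Conj n} {L : List (LinIneq n)} → (∀ x → Sol C x ⇔ All (λ l → holdsLin l x) L) →
  numWeak L ≤ 1 → ∀ {y₀} → Sol C y₀ → ShellingKeys C
shellingKeys {C = C} sol⇔L weak≤1 {y₀} sol₀ with Any.any? (tightIneq? C) C
... | no noTight = record
  { primary = toℕ ∘ rank y₀
  ; secondary = λ _ → 0
  ; primary-sat = rank-sat y₀ (proj₂ sol₀)
  ; tight-oriented = λ (a≤b∈C , a≢b , tight) → ⊥-elim (noTight (lose a≤b∈C (a≢b , tight)))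
  }
... | yes someTight with find someTight
...   | bineq a₀ b₀ weak , a₀≤b₀∈C , a₀≢b₀ , y , sol , tie = record
  { primary = toℕ ∘ rank y
  ; secondary = λ c → indicator (toℕ c) (toℕ a₀)
  ; primary-sat = rank-sat y (proj₂ sol)
  ; tight-oriented = oriented
  }
  where
  oriented : ∀ {a b} → TightEdge C a b → toℕ (rank y a) ≡ toℕ (rank y b) × indicator (toℕ b) (toℕ a₀) < indicator (toℕ a) (toℕ a₀)
  oriented tight with TightEdges.tightEdge-unique sol⇔L weak≤1 tight (a₀≤b₀∈C , a₀≢b₀ , y , sol , tie)
  ... | refl , refl = cong toℕ (rank-tie y tie) , indicator-< (a₀≢b₀ ∘ Fin.toℕ-injective ∘ sym)

mainTheorem4 : (n d : ℕ) (C : Conj n) → AlmostOpen d C → Partitionable d C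
mainTheorem4 n d C (hasDim , L , sol⇔L , _ , weak≤1) = subst (λ d → Partitionable d C) (sym d≡n) partitionable
  where
  y₀-sol : Sol C (proj₁ (proj₁ hasDim) Fin.zero)
  y₀-sol = proj₁ (proj₂ (proj₁ hasDim)) Fin.zero
  keys : ShellingKeys C
  keys = shellingKeys sol⇔L weak≤1 y₀-sol
  open ShellingKeys keys
  open Shelling C ≺-isStrictTotalOrder strict⇒≻ tight⇒≺
  d≡n : d ≡ n
  d≡n = dim≡n C hasDim (sort primary) (sort-surjective primary) (sort-sat primary primary-sat)
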